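{- In the setting described in the context, if $D\subsetneq B$ then $\deg(v,AC^{k-2})>k|B||A|\binom{|C|}{k-3}$ for every vertex $v\in B\setminus D$.
   Context: Let $k\ge 3$, let $\varepsilon>0$ be sufficiently small in terms of $k$, let $n$ be sufficiently large in terms of $k,\varepsilon$ with $k\mid n$, and let $c$ be an integer with $0\le c\le\varepsilon n/k$. Let $H$ be a $k$-uniform hypergraph on vertex set $V$, $|V|=n$, with $\delta_{k-1}(H)\ge n/k-c$. Assume $H$ has an independent set $S$ with $|S|\ge(1-\varepsilon)\frac{k-1}{k}n$; let $C$ be a maximal independent set containing $S$, and assume $|C|\le\frac{(k-1)n}{k}$. Let $\alpha=\varepsilon^{1/3}$. For $x\in V\setminus C$ let $\deg(x,C)$ be the number of edges $e\ni x$ with $e\setminus\{x\}\subseteq C$. Let $A=\{x\in V\setminus C:\deg(x,C)\ge(1-\alpha)\binom{|C|}{k-1}\}$ and $B=V\setminus(A\cup C)$. List $B$ as $v_1,\dots,v_{|B|}$ with $\deg(v_i,C)$ non-increasing; let $d$ be the largest positive integer with $\deg(v_d,C)>(d+c)(k-1)\binom{|C|}{k-2}$ ($d=0$ if none exists), and $D=\{v_1,\dots,v_d\}$. For a vertex $v$, $\deg(v,AC^{k-2})$ is the number of $(k-1)$-sets $T$ with $T\cup\{v\}\in E(H)$, $|T\cap A|=1$ and $|T\cap C|=k-2$. -}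

module Defs where

open import Data.Bool using (Bool; true; false; _∧_; not)
open import Data.Nat as ℕ using (ℕ; zero; suc; _+_; _*_; _∸_; _≤_; _<_)
open import Data.Nat.Combinatorics using () renaming (_C_ to binom)
open import Data.Fin using (Fin; toℕ)
open import Data.Fin.Subset using (Subset; _∈_; _∉_; _⊆_; _∪_; _∩_; _─_; ⁅_⁆; ∣_∣)
open import Data.Fin.Subset.Properties using (_∈?_; _⊆?_)
open import Data.List as L using (List; []; _∷_; _++_; length; filter; lookup; take)
open import Data.Vec as V using (Vec; []; _∷_; tabulate)
open import Data.Product using (Σ; _×_; _,_)
open import Data.Sum using (_⊎_)
open import Data.Integer using (+_)
open import Data.Rational as Q using (ℚ; _/_)
open import Data.Rational.Properties using () renaming (_≤?_ to _≤ℚ?_)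
open import Relation.Nullary using (¬_; Dec; yes; no; ¬?; does)
open import Relation.Nullary.Decidable using (_×-dec_)
open import Relation.Binary.PropositionalEquality using (_≡_)
open import Data.List.Relation.Unary.AllPairs using (AllPairs)
open import Data.List.Relation.Unary.Unique.Propositional using (Unique)
import Data.List.Membership.Propositional as LM

ℕ→ℚ : ℕ → ℚ
ℕ→ℚ m = (+ m) / 1

allSubsets : (n : ℕ) → List (Subset n)
allSubsets zero = [] ∷ []
allSubsets (suc n) = L.map (false ∷_) (allSubsets n) ++ L.map (true ∷_) (allSubsets n)

allVertices : (n : ℕ) → List (Fin n)
allVertices n = L.allFin n

Hypergraph : ℕ → Set
Hypergraph n = Subset n → Bool

IsEdge : ∀ {n} → Hypergraph n → Subset n → Set
IsEdge H e = H e ≡ true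

Uniform : ∀ {n} → ℕ → Hypergraph n → Set
Uniform {n} k H = (e : Subset n) → IsEdge H e → ∣ e ∣ ≡ k

codeg : ∀ {n} → Hypergraph n → Subset n → ℕ
codeg {n} H T =
  length (filter (λ v → ¬? (v ∈? T) ×-dec (H (T ∪ ⁅ v ⁆) Data.Bool.≟ true)) (allVertices n))

Independent : ∀ {n} → Hypergraph n → Subset n → Set
Independent {n} H S = (e : Subset n) → IsEdge H e → ¬ (e ⊆ S)

MaximalIndependent : ∀ {n} → Hypergraph n → Subset n → Set
MaximalIndependent {n} H C =
  Independent H C × ((v : Fin n) → v ∉ C → ¬ Independent H (C ∪ ⁅ v ⁆))

degC : ∀ {n} → Hypergraph n → Subset n → Fin n → ℕ
degC {n} H C x =
  length (filter (λ e → (H e Data.Bool.≟ true) ×-dec (x ∈? e) ×-dec ((e ─ ⁅ x ⁆) ⊆? C))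
                 (allSubsets n))

-- The condition deg(x,C) ≥ (1 - α) M with α = ε^{1/3}, M = binom(|C|, k-1).
-- Since t ↦ t³ is strictly increasing on ℚ, (M - deg) ≤ α M  ⇔  (M - deg)³ ≤ ε M³.
HighDeg : ℚ → ℕ → ℕ → Set
HighDeg ε M dg = let t = ℕ→ℚ M Q.- ℕ→ℚ dg in (t Q.* t Q.* t) Q.≤ (ε Q.* ℕ→ℚ M Q.* ℕ→ℚ M Q.* ℕ→ℚ M)

highDeg? : ∀ ε M dg → Dec (HighDeg ε M dg)
highDeg? ε M dg = _ ≤ℚ? _

Aset : ∀ {n} → ℕ → ℚ → Hypergraph n → Subset n → Subset n
Aset k ε H C = tabulate λ x → does (¬? (x ∈? C) ×-dec highDeg? ε (binom ∣ C ∣ (k ∸ 1)) (degC H C x))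

Bset : ∀ {n} → ℕ → ℚ → Hypergraph n → Subset n → Subset n
Bset k ε H C = tabulate λ x → not (does (x ∈? (Aset k ε H C ∪ C)))

degAC : ∀ {n} → ℕ → Hypergraph n → Subset n → Subset n → Fin n → ℕ
degAC {n} k H A C v =
  length (filter (λ T → (∣ T ∣ ℕ.≟ (k ∸ 1)) ×-dec (H (T ∪ ⁅ v ⁆) Data.Bool.≟ true)
                         ×-dec (∣ T ∩ A ∣ ℕ.≟ 1) ×-dec (∣ T ∩ C ∣ ℕ.≟ (k ∸ 2)))
                 (allSubsets n))

IsDegListing : ∀ {n} → Hypergraph n → Subset n → Subset n → List (Fin n) → Set
IsDegListing {n} H C B vs =
  Unique vs
  × ((x : Fin n) → (LM._∈_ x vs → x ∈ B) × (x ∈ B → LM._∈_ x vs))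
  × AllPairs (λ x y → degC H C y ≤ degC H C x) vs

-- the defining inequality for index i (1-based index toℕ i + 1):
--   deg(v_i, C) > (i + c)(k-1) binom(|C|, k-2)
DCond : ∀ {n} → ℕ → ℕ → Hypergraph n → Subset n → (vs : List (Fin n)) → Fin (length vs) → Set
DCond k c H C vs i =
  (toℕ i + 1 + c) * (k ∸ 1) * (binom ∣ C ∣ (k ∸ 2)) < degC H C (lookup vs i)

IsD : ∀ {n} → ℕ → ℕ → Hypergraph n → Subset n → (vs : List (Fin n)) → ℕ → Set
IsD k c H C vs d =
  (d ≡ 0 × ((i : Fin (length vs)) → ¬ DCond k c H C vs i))
  ⊎ Σ (Fin (length vs)) λ i → d ≡ toℕ i + 1 × DCond k c H C vs i
      × ((j : Fin (length vs)) → toℕ i < toℕ j → ¬ DCond k c H C vs j)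

Dlist : ∀ {n} → List (Fin n) → ℕ → List (Fin n)
Dlist vs d = take d vs

{-# OPTIONS --safe #-}
-- Every (k-1)-subset of the independent set C has codegree at least n/k - c, and all these
-- edges meet V ∖ C = A ∪ B, whose vertices each lie in at most binom(|C|, k-1) of them.
-- Summing codegrees therefore bounds the total deficiency Σ_{x ∈ B} (binom(|C|, k-1) - deg(x, C))
-- by about ε n binom(|C|, k-1); since every vertex of B has deficiency above
-- ε^{1/3} binom(|C|, k-1), this gives |B| < ε^{2/3} n.  For v ∈ B ∖ D, sum instead the codegrees
-- of S ∪ {v} over the (k-2)-subsets S of C: a third vertex in C is counted by
-- deg(v, C) ≤ (|B| + c)(k-1) binom(|C|, k-2) (as v ∉ D), one in B by |B|, and one in A by
-- deg(v, AC^{k-2}).  So deg(v, AC^{k-2}) ≥ (3/4) n binom(|C|, k-2) / k, which beats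
-- k |B| |A| binom(|C|, k-3) ≤ 3k² |B| n binom(|C|, k-2) / |C| because |C| ≥ n/2 and |B| is tiny.
module Submission where

open import Defs
open import Data.Nat using (ℕ; _+_; _*_; _∸_; _≤_; _<_)
open import Data.Nat.Divisibility using (_∣_)
open import Data.Nat.Combinatorics using () renaming (_C_ to binom)
open import Data.Fin using (Fin)
open import Data.Fin.Subset using (Subset; _∈_; _⊆_; ∣_∣)
open import Data.List using (List; length)
open import Data.List.Membership.Propositional using () renaming (_∈_ to _∈ˡ_)
open import Data.Product using (Σ; _×_)
open import Data.Rational using (ℚ; 0ℚ; 1ℚ) renaming (_<_ to _<ℚ_; _≤_ to _≤ℚ_; _*_ to _*ℚ_; _-_ to _-ℚ_)
open import Relation.Nullary using (¬_)
open import Relation.Binary.PropositionalEquality using (_≡_)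

open import Data.Bool as Bool using (Bool; true; false; not; _∧_; _∨_)
open import Data.Bool.Properties using (∧-identityʳ; ∨-identityʳ; ∧-zeroʳ; ∧-comm)
open import Data.Empty using (⊥-elim)
open import Data.Fin using (zero; suc; toℕ)
open import Data.Fin.Properties using (toℕ<n)
open import Data.Fin.Subset using (⁅_⁆; _∪_; _∩_; _─_) renaming (⊥ to ∅)
open import Data.Fin.Subset.Properties
  using (_∈?_; _⊆?_; x∈⁅y⁆⇒x≡y; ∪-identityʳ; ∪-assoc; ∪-comm; ∣⁅x⁆∣≡1; ∣p∩q∣≤∣p∣; p⊆q⇒∣p∣≤∣q∣)
import Data.Integer as ℤ
import Data.Integer.Properties as ℤₚ
open import Data.List using ([]; _∷_; _++_; map; filter; take; lookup)
import Data.List.Properties as List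
open import Data.List.Extrema.Nat using (argmin; f[argmin]≤f[xs]; argmin-all)
open import Data.List.Membership.Propositional.Properties using (∈-filter⁺; ∈-allFin)
open import Data.List.Relation.Unary.All as All using (All)
open import Data.List.Relation.Unary.All.Properties using (all-filter)
open import Data.List.Relation.Unary.AllPairs using (_∷_)
open import Data.List.Relation.Unary.Any as Any using (here; there)
open import Data.List.Relation.Unary.Any.Properties using (lookup-index)
open import Data.List.Relation.Unary.Unique.Propositional using (Unique)
open import Data.Nat using (zero; suc; z≤n; s≤s; _≡ᵇ_; _≟_; _≤?_; _<?_; NonZero; >-nonZero)
open import Data.Nat.Combinatorics using (nCk+nC[k+1]≡[n+1]C[k+1]; nC1≡n; k>n⇒nCk≡0)
open import Data.Nat.Coprimality as Coprimality using (Coprime; 1-coprimeTo)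
open import Data.Nat.ListAction using (sum)
open import Data.Nat.ListAction.Properties using (sum-++)
open import Data.Nat.Properties
open import Data.Nat.Solver using (module +-*-Solver)
open import Data.Product using (∃; _,_; proj₁; proj₂)
open import Data.Rational as ℚ using (mkℚ)
import Data.Rational.Properties as ℚₚ
open import Data.Rational.Solver using () renaming (module +-*-Solver to ℚ-Solver)
import Data.Rational.Unnormalised as ℚᵘ
import Data.Rational.Unnormalised.Properties as ℚᵘₚ
open import Data.Sum using (inj₁; inj₂)
open import Data.Vec using ([]; _∷_; tabulate)
open import Function using (_∘_)
open import Relation.Binary.PropositionalEquality
  using (module ≡-Reasoning; _≢_; refl; sym; trans; cong; cong₂; subst; subst₂)
open import Relation.Nullary using (Dec; yes; no; does)
open import Relation.Nullary.Decidable using (dec-true; dec-false)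

⟦_⟧ : Bool → ℕ
⟦ true ⟧ = 1
⟦ false ⟧ = 0

∑ : {A : Set} → List A → (A → ℕ) → ℕ
∑ xs f = sum (map f xs)

-- ∑[ x ← xs ] binds tighter than _+_ and _*_, so a body using them is parenthesised.
infix 9 ∑
syntax ∑ xs (λ x → e) = ∑[ x ← xs ] e

private variable X Y : Set

∑-cong : ∀ xs {f g : X → ℕ} → (∀ x → f x ≡ g x) → ∑ xs f ≡ ∑ xs g
∑-cong xs f≗g = cong sum (List.map-cong f≗g xs)

∑-mono-≤ : ∀ xs {f g : X → ℕ} → (∀ x → f x ≤ g x) → ∑ xs f ≤ ∑ xs g
∑-mono-≤ []       f≤g = z≤n
∑-mono-≤ (x ∷ xs) f≤g = +-mono-≤ (f≤g x) (∑-mono-≤ xs f≤g)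

∑-zero : ∀ (xs : List X) → ∑[ x ← xs ] 0 ≡ 0
∑-zero []       = refl
∑-zero (x ∷ xs) = ∑-zero xs

∑-distrib-+ : ∀ xs (f g : X → ℕ) → ∑[ x ← xs ] (f x + g x) ≡ ∑ xs f + ∑ xs g
∑-distrib-+ []       f g = refl
∑-distrib-+ (x ∷ xs) f g = trans (cong (f x + g x +_) (∑-distrib-+ xs f g))
  (solve 4 (λ a b c d → a :+ b :+ (c :+ d) := a :+ c :+ (b :+ d)) refl (f x) (g x) (∑ xs f) (∑ xs g))
  where open +-*-Solver

*-distribˡ-∑ : ∀ c xs (f : X → ℕ) → c * ∑ xs f ≡ ∑[ x ← xs ] (c * f x)
*-distribˡ-∑ c []       f = *-zeroʳ c
*-distribˡ-∑ c (x ∷ xs) f =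
  trans (*-distribˡ-+ c (f x) _) (cong (c * f x +_) (*-distribˡ-∑ c xs f))

*-distribʳ-∑ : ∀ c xs (f : X → ℕ) → ∑ xs f * c ≡ ∑[ x ← xs ] (f x * c)
*-distribʳ-∑ c xs f = trans (*-comm (∑ xs f) c)
  (trans (*-distribˡ-∑ c xs f) (∑-cong xs (λ x → *-comm c (f x))))

∑-++ : ∀ xs ys (f : X → ℕ) → ∑ (xs ++ ys) f ≡ ∑ xs f + ∑ ys f
∑-++ xs ys f = trans (cong sum (List.map-++ f xs ys)) (sum-++ (map f xs) (map f ys))

∑-map : ∀ (g : Y → X) xs (f : X → ℕ) → ∑ (map g xs) f ≡ ∑ xs (f ∘ g)
∑-map g xs f = cong sum (sym (List.map-∘ xs))

∑-comm : ∀ xs (ys : List Y) (f : X → Y → ℕ) →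
         ∑[ x ← xs ] ∑ ys (f x) ≡ ∑[ y ← ys ] ∑[ x ← xs ] f x y
∑-comm []       ys f = sym (∑-zero ys)
∑-comm (x ∷ xs) ys f = begin
  ∑ ys (f x) + (∑[ x′ ← xs ] ∑ ys (f x′))       ≡⟨ cong (∑ ys (f x) +_) (∑-comm xs ys f) ⟩
  ∑ ys (f x) + (∑[ y ← ys ] ∑[ x′ ← xs ] f x′ y) ≡⟨ sym (∑-distrib-+ ys (f x) _) ⟩
  ∑[ y ← ys ] (f x y + (∑[ x′ ← xs ] f x′ y))    ∎
  where open ≡-Reasoning

∑∑-distrib-+ : ∀ xs (ys : List Y) (f g : X → Y → ℕ) →
               ∑[ x ← xs ] ∑[ y ← ys ] (f x y + g x y) ≡ ∑[ x ← xs ] ∑ ys (f x) + ∑[ x ← xs ] ∑ ys (g x)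
∑∑-distrib-+ xs ys f g = trans (∑-cong xs (λ x → ∑-distrib-+ ys (f x) (g x))) (∑-distrib-+ xs _ _)

∑-1 : ∀ (xs : List X) → ∑[ x ← xs ] 1 ≡ length xs
∑-1 []       = refl
∑-1 (x ∷ xs) = cong suc (∑-1 xs)

length-filter≡∑ : ∀ {P : X → Set} (P? : ∀ x → Dec (P x)) xs →
                  length (filter P? xs) ≡ ∑[ x ← xs ] ⟦ does (P? x) ⟧
length-filter≡∑ P? []       = refl
length-filter≡∑ P? (x ∷ xs) with does (P? x)
... | true  = cong suc (length-filter≡∑ P? xs)
... | false = length-filter≡∑ P? xs

∑-allVertices-suc : ∀ n (f : Fin (suc n) → ℕ) →
                    ∑ (allVertices (suc n)) f ≡ f zero + ∑ (allVertices n) (f ∘ suc)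
∑-allVertices-suc n f = cong (f zero +_)
  (trans (cong sum (List.map-tabulate suc f)) (sym (cong sum (List.map-tabulate (λ i → i) (f ∘ suc)))))

∑-allSubsets-suc : ∀ n (f : Subset (suc n) → ℕ) →
                   ∑ (allSubsets (suc n)) f ≡ (∑[ S ← allSubsets n ] f (false ∷ S)) + ∑[ S ← allSubsets n ] f (true ∷ S)
∑-allSubsets-suc n f = trans (∑-++ (map (false ∷_) (allSubsets n)) _ f)
  (cong₂ _+_ (∑-map (false ∷_) (allSubsets n) f) (∑-map (true ∷_) (allSubsets n) f))

true≢false : true ≢ false
true≢false ()

does-true : ∀ {P : Set} (P? : Dec P) → does P? ≡ true → P
does-true (yes p) _ = p

does-false : ∀ {P : Set} (P? : Dec P) → does P? ≡ false → ¬ P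
does-false (no ¬p) _ = ¬p

infix 4.5 _∈ᵇ_ _⊆ᵇ_

_∈ᵇ_ : ∀ {n} → Fin n → Subset n → Bool
x ∈ᵇ p = does (x ∈? p)

_⊆ᵇ_ : ∀ {n} → Subset n → Subset n → Bool
p ⊆ᵇ q = does (p ⊆? q)

module _ {n : ℕ} where

  ∈ᵇ⇒∈ : {x : Fin n} {p : Subset n} → x ∈ᵇ p ≡ true → x ∈ p
  ∈ᵇ⇒∈ {x} {p} = does-true (x ∈? p)

  ∈⇒∈ᵇ : {x : Fin n} {p : Subset n} → x ∈ p → x ∈ᵇ p ≡ true
  ∈⇒∈ᵇ {x} {p} = dec-true (x ∈? p)

  ⊆ᵇ⇒∈ᵇ : {p q : Subset n} → p ⊆ᵇ q ≡ true → ∀ x → x ∈ᵇ p ≡ true → x ∈ᵇ q ≡ true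
  ⊆ᵇ⇒∈ᵇ {p} {q} p⊆q x x∈p = ∈⇒∈ᵇ {x} {q} (does-true (p ⊆? q) p⊆q (∈ᵇ⇒∈ {x} {p} x∈p))

  ∈ᵇ⇒⊆ᵇ : {p q : Subset n} → (∀ x → x ∈ᵇ p ≡ true → x ∈ᵇ q ≡ true) → p ⊆ᵇ q ≡ true
  ∈ᵇ⇒⊆ᵇ {p} {q} p⊆q = dec-true (p ⊆? q) (λ {x} x∈p → ∈ᵇ⇒∈ {x} {q} (p⊆q x (∈⇒∈ᵇ {x} {p} x∈p)))

  ⊆ᵇ-∉ : {p q : Subset n} → p ⊆ᵇ q ≡ true → ∀ x → x ∈ᵇ q ≡ false → x ∈ᵇ p ≡ false
  ⊆ᵇ-∉ {p} p⊆q x x∉q with x ∈ᵇ p in x∈p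
  ... | false = refl
  ... | true  = trans (sym (⊆ᵇ⇒∈ᵇ p⊆q x x∈p)) x∉q

  ⊆ᵇ-false : {p q : Subset n} → ∀ x → x ∈ᵇ p ≡ true → x ∈ᵇ q ≡ false → p ⊆ᵇ q ≡ false
  ⊆ᵇ-false {p} {q} x x∈p x∉q with p ⊆ᵇ q in p⊆q
  ... | false = refl
  ... | true  = trans (sym (⊆ᵇ⇒∈ᵇ p⊆q x x∈p)) x∉q

zero-∈ᵇ-∷ : ∀ {n} b (p : Subset n) → zero ∈ᵇ (b ∷ p) ≡ b
zero-∈ᵇ-∷ true  p = refl
zero-∈ᵇ-∷ false p = refl

∈ᵇ-tabulate : ∀ {n} (f : Fin n → Bool) x → x ∈ᵇ tabulate f ≡ f x
∈ᵇ-tabulate f zero    = zero-∈ᵇ-∷ (f zero) _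
∈ᵇ-tabulate f (suc x) = ∈ᵇ-tabulate (f ∘ suc) x

∈ᵇ-∪ : ∀ {n} x (p q : Subset n) → x ∈ᵇ p ∪ q ≡ ((x ∈ᵇ p) ∨ (x ∈ᵇ q))
∈ᵇ-∪ zero    (a ∷ p) (b ∷ q) = trans (zero-∈ᵇ-∷ (a ∨ b) _) (sym (cong₂ _∨_ (zero-∈ᵇ-∷ a p) (zero-∈ᵇ-∷ b q)))
∈ᵇ-∪ (suc x) (a ∷ p) (b ∷ q) = ∈ᵇ-∪ x p q

∈ᵇ-∩ : ∀ {n} x (p q : Subset n) → x ∈ᵇ p ∩ q ≡ ((x ∈ᵇ p) ∧ (x ∈ᵇ q))
∈ᵇ-∩ zero    (a ∷ p) (b ∷ q) = trans (zero-∈ᵇ-∷ (a ∧ b) _) (sym (cong₂ _∧_ (zero-∈ᵇ-∷ a p) (zero-∈ᵇ-∷ b q)))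
∈ᵇ-∩ (suc x) (a ∷ p) (b ∷ q) = ∈ᵇ-∩ x p q

∈ᵇ-─ : ∀ {n} x (p q : Subset n) → x ∈ᵇ p ─ q ≡ ((x ∈ᵇ p) ∧ not (x ∈ᵇ q))
∈ᵇ-─ zero    (true  ∷ p) (true  ∷ q) = refl
∈ᵇ-─ zero    (true  ∷ p) (false ∷ q) = refl
∈ᵇ-─ zero    (false ∷ p) (true  ∷ q) = refl
∈ᵇ-─ zero    (false ∷ p) (false ∷ q) = refl
∈ᵇ-─ (suc x) (a ∷ p)     (b ∷ q)     = ∈ᵇ-─ x p q

∈ᵇ-∅ : ∀ {n} (x : Fin n) → x ∈ᵇ ∅ ≡ false
∈ᵇ-∅ zero    = refl
∈ᵇ-∅ (suc x) = ∈ᵇ-∅ x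


x∈ᵇ⁅y⁆⇒x≡y : ∀ {n} (x y : Fin n) → x ∈ᵇ ⁅ y ⁆ ≡ true → x ≡ y
x∈ᵇ⁅y⁆⇒x≡y x y x∈y = x∈⁅y⁆⇒x≡y y (∈ᵇ⇒∈ {x = x} {⁅ y ⁆} x∈y)

x∉ᵇ⁅y⁆ : ∀ {n} {x y : Fin n} → x ≢ y → x ∈ᵇ ⁅ y ⁆ ≡ false
x∉ᵇ⁅y⁆ {x = x} {y} x≢y = dec-false (x ∈? ⁅ y ⁆) (x≢y ∘ x∈⁅y⁆⇒x≡y y)

Subset-ext : ∀ {n} {p q : Subset n} → (∀ x → x ∈ᵇ p ≡ x ∈ᵇ q) → p ≡ q
Subset-ext {p = []}    {[]}    _   = refl
Subset-ext {p = a ∷ p} {b ∷ q} p≐q =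
  cong₂ _∷_ (trans (sym (zero-∈ᵇ-∷ a p)) (trans (p≐q zero) (zero-∈ᵇ-∷ b q))) (Subset-ext (p≐q ∘ suc))

∣∣≡∑ : ∀ {n} (p : Subset n) → ∣ p ∣ ≡ ∑[ x ← allVertices n ] ⟦ x ∈ᵇ p ⟧
∣∣≡∑ []      = refl
∣∣≡∑ {suc n} (b ∷ p) = trans (lemma b) (sym (trans (∑-allVertices-suc n _) (cong (_+ _) (cong ⟦_⟧ (zero-∈ᵇ-∷ b p)))))
  where
  lemma : ∀ b → ∣ b ∷ p ∣ ≡ ⟦ b ⟧ + (∑[ x ← allVertices n ] ⟦ x ∈ᵇ p ⟧)
  lemma true  = cong suc (∣∣≡∑ p)
  lemma false = ∣∣≡∑ p

∨-∧-selectˡ : ∀ s e c → (s ≡ true → c ≡ true) → (e ≡ true → c ≡ false) → (s ∨ e) ∧ c ≡ s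
∨-∧-selectˡ true  e     true  _ _ = refl
∨-∧-selectˡ true  e     false h _ with () ← h refl
∨-∧-selectˡ false true  true  _ h with () ← h refl
∨-∧-selectˡ false true  false _ _ = refl
∨-∧-selectˡ false false c     _ _ = refl

∨-∧-selectʳ : ∀ s e c → (s ≡ true → c ≡ false) → (e ≡ true → c ≡ true) → (s ∨ e) ∧ c ≡ e
∨-∧-selectʳ true  e     true  h _ with () ← h refl
∨-∧-selectʳ true  true  false _ h with () ← h refl
∨-∧-selectʳ true  false false _ _ = refl
∨-∧-selectʳ false true  true  _ _ = refl
∨-∧-selectʳ false true  false _ h with () ← h refl
∨-∧-selectʳ false false c     _ _ = refl

∨-∧-not : ∀ s e → (e ≡ true → s ≡ false) → (s ∨ e) ∧ not e ≡ s
∨-∧-not s     false _ = trans (∧-identityʳ (s ∨ false)) (∨-identityʳ s)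
∨-∧-not true  true  h with () ← h refl
∨-∧-not false true  _ = refl

module _ {n : ℕ} where
  open ≡-Reasoning

  ∈⁅x⁆⇒∉ : {S : Subset n} {x : Fin n} → x ∈ᵇ S ≡ false → ∀ y → y ∈ᵇ ⁅ x ⁆ ≡ true → y ∈ᵇ S ≡ false
  ∈⁅x⁆⇒∉ {S} {x} x∉S y y∈x = subst (λ z → z ∈ᵇ S ≡ false) (sym (x∈ᵇ⁅y⁆⇒x≡y y x y∈x)) x∉S

  ∪⁅⁆─⁅⁆ : (S : Subset n) (x : Fin n) → x ∈ᵇ S ≡ false → (S ∪ ⁅ x ⁆) ─ ⁅ x ⁆ ≡ S
  ∪⁅⁆─⁅⁆ S x x∉S = Subset-ext λ y → begin
    y ∈ᵇ (S ∪ ⁅ x ⁆) ─ ⁅ x ⁆                    ≡⟨ ∈ᵇ-─ y (S ∪ ⁅ x ⁆) ⁅ x ⁆ ⟩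
    (y ∈ᵇ S ∪ ⁅ x ⁆) ∧ not (y ∈ᵇ ⁅ x ⁆)         ≡⟨ cong (_∧ not (y ∈ᵇ ⁅ x ⁆)) (∈ᵇ-∪ y S ⁅ x ⁆) ⟩
    ((y ∈ᵇ S) ∨ (y ∈ᵇ ⁅ x ⁆)) ∧ not (y ∈ᵇ ⁅ x ⁆) ≡⟨ ∨-∧-not (y ∈ᵇ S) (y ∈ᵇ ⁅ x ⁆) (∈⁅x⁆⇒∉ x∉S y) ⟩
    y ∈ᵇ S                                      ∎

  ∪⁅⁆∩-⊆ : (S C : Subset n) (w : Fin n) → S ⊆ᵇ C ≡ true → w ∈ᵇ C ≡ false → (S ∪ ⁅ w ⁆) ∩ C ≡ S
  ∪⁅⁆∩-⊆ S C w S⊆C w∉C = Subset-ext λ y → begin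
    y ∈ᵇ (S ∪ ⁅ w ⁆) ∩ C                 ≡⟨ ∈ᵇ-∩ y (S ∪ ⁅ w ⁆) C ⟩
    (y ∈ᵇ S ∪ ⁅ w ⁆) ∧ (y ∈ᵇ C)           ≡⟨ cong (_∧ (y ∈ᵇ C)) (∈ᵇ-∪ y S ⁅ w ⁆) ⟩
    ((y ∈ᵇ S) ∨ (y ∈ᵇ ⁅ w ⁆)) ∧ (y ∈ᵇ C) ≡⟨ ∨-∧-selectˡ _ _ _ (⊆ᵇ⇒∈ᵇ S⊆C y) (∈⁅x⁆⇒∉ w∉C y) ⟩
    y ∈ᵇ S                               ∎

  ∪⁅⁆∩-disjoint : (S C A : Subset n) (w : Fin n) → S ⊆ᵇ C ≡ true → w ∈ᵇ A ≡ true →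
                  (∀ y → y ∈ᵇ A ≡ true → y ∈ᵇ C ≡ false) → (S ∪ ⁅ w ⁆) ∩ A ≡ ⁅ w ⁆
  ∪⁅⁆∩-disjoint S C A w S⊆C w∈A A∩C≡∅ = Subset-ext λ y → begin
    y ∈ᵇ (S ∪ ⁅ w ⁆) ∩ A                 ≡⟨ ∈ᵇ-∩ y (S ∪ ⁅ w ⁆) A ⟩
    (y ∈ᵇ S ∪ ⁅ w ⁆) ∧ (y ∈ᵇ A)           ≡⟨ cong (_∧ (y ∈ᵇ A)) (∈ᵇ-∪ y S ⁅ w ⁆) ⟩
    ((y ∈ᵇ S) ∨ (y ∈ᵇ ⁅ w ⁆)) ∧ (y ∈ᵇ A)
      ≡⟨ ∨-∧-selectʳ _ _ _ (S∌A y) (λ y∈w → subst (λ z → z ∈ᵇ A ≡ true) (sym (x∈ᵇ⁅y⁆⇒x≡y y w y∈w)) w∈A) ⟩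
    y ∈ᵇ ⁅ w ⁆                           ∎
    where
    S∌A : ∀ y → y ∈ᵇ S ≡ true → y ∈ᵇ A ≡ false
    S∌A y y∈S with y ∈ᵇ A in y∈A
    ... | false = refl
    ... | true  = trans (sym (⊆ᵇ⇒∈ᵇ S⊆C y y∈S)) (A∩C≡∅ y y∈A)

  ∪⁅⁆-⊆ᵇ : (S C : Subset n) (w : Fin n) → S ⊆ᵇ C ≡ true → w ∈ᵇ C ≡ true → S ∪ ⁅ w ⁆ ⊆ᵇ C ≡ true
  ∪⁅⁆-⊆ᵇ S C w S⊆C w∈C = ∈ᵇ⇒⊆ᵇ λ y y∈S∪w → lemma y (y ∈ᵇ S) refl (trans (sym (∈ᵇ-∪ y S ⁅ w ⁆)) y∈S∪w)
    where
    lemma : ∀ y s → y ∈ᵇ S ≡ s → s ∨ (y ∈ᵇ ⁅ w ⁆) ≡ true → y ∈ᵇ C ≡ true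
    lemma y true  y∈S _   = ⊆ᵇ⇒∈ᵇ S⊆C y y∈S
    lemma y false _   y∈w = subst (λ z → z ∈ᵇ C ≡ true) (sym (x∈ᵇ⁅y⁆⇒x≡y y w y∈w)) w∈C

∣∪⁅⁆∣ : ∀ {n} (S : Subset n) x → x ∈ᵇ S ≡ false → ∣ S ∪ ⁅ x ⁆ ∣ ≡ suc ∣ S ∣
∣∪⁅⁆∣ (false ∷ S) zero    _   = cong (suc ∘ ∣_∣) (∪-identityʳ S)
∣∪⁅⁆∣ (true  ∷ S) (suc x) x∉S = cong suc (∣∪⁅⁆∣ S x x∉S)
∣∪⁅⁆∣ (false ∷ S) (suc x) x∉S = ∣∪⁅⁆∣ S x x∉S

⟦∧⟧ : ∀ a b → ⟦ a ∧ b ⟧ ≡ ⟦ a ⟧ * ⟦ b ⟧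
⟦∧⟧ true  b = sym (+-identityʳ ⟦ b ⟧)
⟦∧⟧ false b = refl

⟦⟧≤1 : ∀ b → ⟦ b ⟧ ≤ 1
⟦⟧≤1 true  = ≤-refl
⟦⟧≤1 false = z≤n

subsetOfSize : ∀ {n} → Subset n → ℕ → Subset n → Bool
subsetOfSize C j T = (T ⊆ᵇ C) ∧ (∣ T ∣ ≡ᵇ j)

∑-subsetOfSize : ∀ {n} (C : Subset n) j → ∑[ T ← allSubsets n ] ⟦ subsetOfSize C j T ⟧ ≡ binom ∣ C ∣ j
∑-subsetOfSize []          zero    = refl
∑-subsetOfSize []          (suc j) = refl
∑-subsetOfSize {suc n} (false ∷ C) j = begin
  ∑ (allSubsets (suc n)) (⟦_⟧ ∘ subsetOfSize (false ∷ C) j) ≡⟨ ∑-allSubsets-suc n _ ⟩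
  ∑[ T ← allSubsets n ] ⟦ subsetOfSize C j T ⟧ + (∑[ T ← allSubsets n ] 0)
    ≡⟨ cong₂ _+_ (∑-subsetOfSize C j) (∑-zero (allSubsets n)) ⟩
  binom (∣ C ∣) j + 0                                   ≡⟨ +-identityʳ _ ⟩
  binom (∣ C ∣) j                                       ∎
  where open ≡-Reasoning
∑-subsetOfSize {suc n} (true ∷ C) zero = begin
  ∑ (allSubsets (suc n)) (⟦_⟧ ∘ subsetOfSize (true ∷ C) 0) ≡⟨ ∑-allSubsets-suc n _ ⟩
  ∑[ T ← allSubsets n ] ⟦ subsetOfSize C 0 T ⟧ + (∑[ T ← allSubsets n ] ⟦ (T ⊆ᵇ C) ∧ false ⟧)
    ≡⟨ cong₂ _+_ (∑-subsetOfSize C 0) (trans (∑-cong (allSubsets n) (λ T → cong ⟦_⟧ (∧-zeroʳ (T ⊆ᵇ C)))) (∑-zero (allSubsets n))) ⟩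
  1 + 0                                                ∎
  where open ≡-Reasoning
∑-subsetOfSize {suc n} (true ∷ C) (suc j) = begin
  ∑ (allSubsets (suc n)) (⟦_⟧ ∘ subsetOfSize (true ∷ C) (suc j)) ≡⟨ ∑-allSubsets-suc n _ ⟩
  ∑[ T ← allSubsets n ] ⟦ subsetOfSize C (suc j) T ⟧ + (∑[ T ← allSubsets n ] ⟦ subsetOfSize C j T ⟧)
    ≡⟨ cong₂ _+_ (∑-subsetOfSize C (suc j)) (∑-subsetOfSize C j) ⟩
  binom (∣ C ∣) (suc j) + binom (∣ C ∣) j                  ≡⟨ +-comm _ (binom (∣ C ∣) j) ⟩
  binom (∣ C ∣) j + binom (∣ C ∣) (suc j)                  ≡⟨ nCk+nC[k+1]≡[n+1]C[k+1] ∣ C ∣ j ⟩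
  binom (suc (∣ C ∣)) (suc j)                            ∎
  where open ≡-Reasoning

∑-insert : ∀ n (w : Fin n) (g : Subset n → ℕ) →
           ∑[ S ← allSubsets n ] (⟦ not (w ∈ᵇ S) ⟧ * g (S ∪ ⁅ w ⁆)) ≡ ∑[ T ← allSubsets n ] (⟦ w ∈ᵇ T ⟧ * g T)
∑-insert (suc n) zero g = begin
  ∑ (allSubsets (suc n)) (λ S → ⟦ not (zero ∈ᵇ S) ⟧ * g (S ∪ ⁅ zero ⁆))
    ≡⟨ ∑-allSubsets-suc n _ ⟩
  ∑[ S ← allSubsets n ] (g (true ∷ S ∪ ∅) + 0) + (∑[ S ← allSubsets n ] 0)
    ≡⟨ cong₂ _+_ (∑-cong (allSubsets n) (λ S → cong (λ T → g (true ∷ T) + 0) (∪-identityʳ S))) (∑-zero (allSubsets n)) ⟩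
  ∑[ S ← allSubsets n ] (g (true ∷ S) + 0) + 0
    ≡⟨ trans (+-identityʳ _) (sym (cong (_+ ∑[ T ← allSubsets n ] (g (true ∷ T) + 0)) (∑-zero (allSubsets n)))) ⟩
  ∑[ T ← allSubsets n ] 0 + (∑[ T ← allSubsets n ] (g (true ∷ T) + 0))
    ≡⟨ ∑-allSubsets-suc n _ ⟨
  ∑ (allSubsets (suc n)) (λ T → ⟦ zero ∈ᵇ T ⟧ * g T) ∎
  where open ≡-Reasoning
∑-insert (suc n) (suc w) g = begin
  ∑ (allSubsets (suc n)) (λ S → ⟦ not (suc w ∈ᵇ S) ⟧ * g (S ∪ ⁅ suc w ⁆))
    ≡⟨ ∑-allSubsets-suc n _ ⟩
  ∑[ S ← allSubsets n ] (⟦ not (w ∈ᵇ S) ⟧ * g (false ∷ S ∪ ⁅ w ⁆)) + ∑[ S ← allSubsets n ] (⟦ not (w ∈ᵇ S) ⟧ * g (true ∷ S ∪ ⁅ w ⁆))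
    ≡⟨ cong₂ _+_ (∑-insert n w (g ∘ (false ∷_))) (∑-insert n w (g ∘ (true ∷_))) ⟩
  ∑[ T ← allSubsets n ] (⟦ w ∈ᵇ T ⟧ * g (false ∷ T)) + ∑[ T ← allSubsets n ] (⟦ w ∈ᵇ T ⟧ * g (true ∷ T))
    ≡⟨ ∑-allSubsets-suc n _ ⟨
  ∑ (allSubsets (suc n)) (λ T → ⟦ suc w ∈ᵇ T ⟧ * g T) ∎
  where open ≡-Reasoning

∧-true : ∀ a {b} → a ∧ b ≡ true → a ≡ true × b ≡ true
∧-true true b≡true = refl , b≡true

≡ᵇ-true : ∀ {a b} → a ≡ b → (a ≡ᵇ b) ≡ true
≡ᵇ-true {a} {b} = dec-true (a ≟ b)

≡ᵇ-true⁻¹ : ∀ {a b} → (a ≡ᵇ b) ≡ true → a ≡ b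
≡ᵇ-true⁻¹ {a} {b} = does-true (a ≟ b)

subsetOfSize-true : ∀ {n} (C : Subset n) j T → subsetOfSize C j T ≡ true → T ⊆ᵇ C ≡ true × ∣ T ∣ ≡ j
subsetOfSize-true C j T h = proj₁ (∧-true (T ⊆ᵇ C) h) , ≡ᵇ-true⁻¹ (proj₂ (∧-true (T ⊆ᵇ C) h))

does-≟-true : ∀ b → does (b Bool.≟ true) ≡ b
does-≟-true true  = refl
does-≟-true false = refl

module _ {n : ℕ} (H : Hypergraph n) where

  degC≡∑ : ∀ C x → degC H C x ≡ ∑[ e ← allSubsets n ] ⟦ H e ∧ ((x ∈ᵇ e) ∧ (e ─ ⁅ x ⁆ ⊆ᵇ C)) ⟧
  degC≡∑ C x = trans (length-filter≡∑ _ (allSubsets n))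
    (∑-cong (allSubsets n) λ e → cong (λ b → ⟦ b ∧ ((x ∈ᵇ e) ∧ (e ─ ⁅ x ⁆ ⊆ᵇ C)) ⟧) (does-≟-true (H e)))

  codeg≡∑ : ∀ T → codeg H T ≡ ∑[ v ← allVertices n ] ⟦ not (v ∈ᵇ T) ∧ H (T ∪ ⁅ v ⁆) ⟧
  codeg≡∑ T = trans (length-filter≡∑ _ (allVertices n))
    (∑-cong (allVertices n) λ v → cong (λ b → ⟦ not (v ∈ᵇ T) ∧ b ⟧) (does-≟-true (H (T ∪ ⁅ v ⁆))))

  degAC≡∑ : ∀ k A C v → degAC k H A C v ≡
            ∑[ T ← allSubsets n ] ⟦ (∣ T ∣ ≡ᵇ k ∸ 1) ∧ (H (T ∪ ⁅ v ⁆) ∧ ((∣ T ∩ A ∣ ≡ᵇ 1) ∧ (∣ T ∩ C ∣ ≡ᵇ k ∸ 2))) ⟧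
  degAC≡∑ k A C v = trans (length-filter≡∑ _ (allSubsets n))
    (∑-cong (allSubsets n) λ T → cong (λ b → ⟦ (∣ T ∣ ≡ᵇ k ∸ 1) ∧ (b ∧ ((∣ T ∩ A ∣ ≡ᵇ 1) ∧ (∣ T ∩ C ∣ ≡ᵇ k ∸ 2))) ⟧)
                                      (does-≟-true (H (T ∪ ⁅ v ⁆))))

⟦a∧[b∧c]⟧≡⟦b⟧*⟦a∧c⟧ : ∀ a b c → ⟦ a ∧ (b ∧ c) ⟧ ≡ ⟦ b ⟧ * ⟦ a ∧ c ⟧
⟦a∧[b∧c]⟧≡⟦b⟧*⟦a∧c⟧ true  true  c = sym (+-identityʳ _)
⟦a∧[b∧c]⟧≡⟦b⟧*⟦a∧c⟧ true  false c = refl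
⟦a∧[b∧c]⟧≡⟦b⟧*⟦a∧c⟧ false true  c = refl
⟦a∧[b∧c]⟧≡⟦b⟧*⟦a∧c⟧ false false c = refl


independent⇒¬edge : ∀ {n} {H : Hypergraph n} {C e : Subset n} → Independent H C → e ⊆ᵇ C ≡ true → H e ≡ false
independent⇒¬edge {H = H} {C} {e} indep e⊆C with H e in edge
... | false = refl
... | true  = ⊥-elim (indep e edge (does-true (e ⊆? C) e⊆C))

codegree-sum : ∀ {n} k c (H : Hypergraph n) → ((T : Subset n) → ∣ T ∣ ≡ k ∸ 1 → n ≤ k * (codeg H T + c)) →
  (ι : Subset n → Bool) (φ : Subset n → Subset n) → (∀ S → ι S ≡ true → ∣ φ S ∣ ≡ k ∸ 1) →
  n * ∑[ S ← allSubsets n ] ⟦ ι S ⟧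
    ≤ k * ∑[ S ← allSubsets n ] (⟦ ι S ⟧ * codeg H (φ S)) + k * (c * ∑[ S ← allSubsets n ] ⟦ ι S ⟧)
codegree-sum {n} k c H codegree ι φ ∣φ∣ = begin
  n * ∑ 𝒫 (⟦_⟧ ∘ ι)
    ≡⟨ *-distribˡ-∑ n 𝒫 _ ⟩
  ∑[ S ← 𝒫 ] (n * ⟦ ι S ⟧)
    ≤⟨ ∑-mono-≤ 𝒫 pointwise ⟩
  ∑[ S ← 𝒫 ] (k * (⟦ ι S ⟧ * codeg H (φ S)) + k * (c * ⟦ ι S ⟧))
    ≡⟨ ∑-distrib-+ 𝒫 _ _ ⟩
  ∑[ S ← 𝒫 ] (k * (⟦ ι S ⟧ * codeg H (φ S))) + ∑[ S ← 𝒫 ] (k * (c * ⟦ ι S ⟧))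
    ≡⟨ cong₂ _+_ (sym (*-distribˡ-∑ k 𝒫 _)) (trans (sym (*-distribˡ-∑ k 𝒫 _)) (cong (k *_) (sym (*-distribˡ-∑ c 𝒫 _)))) ⟩
  k * ∑[ S ← 𝒫 ] (⟦ ι S ⟧ * codeg H (φ S)) + k * (c * ∑ 𝒫 (⟦_⟧ ∘ ι)) ∎
  where
  open ≤-Reasoning
  𝒫 = allSubsets n
  pointwise : ∀ S → n * ⟦ ι S ⟧ ≤ k * (⟦ ι S ⟧ * codeg H (φ S)) + k * (c * ⟦ ι S ⟧)
  pointwise S with ι S in ιS
  ... | false = ≤-trans (≤-reflexive (*-zeroʳ n)) z≤n
  ... | true  = begin
    n * 1                              ≡⟨ *-identityʳ n ⟩
    n                                  ≤⟨ codegree (φ S) (∣φ∣ S ιS) ⟩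
    k * (codeg H (φ S) + c)            ≡⟨ *-distribˡ-+ k _ c ⟩
    k * codeg H (φ S) + k * c          ≡⟨ cong₂ (λ a b → k * a + k * b) (sym (+-identityʳ _)) (sym (*-identityʳ c)) ⟩
    k * (1 * codeg H (φ S)) + k * (c * 1) ∎

⟦a∧b⟧≤⟦b⟧ : ∀ a b → ⟦ a ∧ b ⟧ ≤ ⟦ b ⟧
⟦a∧b⟧≤⟦b⟧ true  b = ≤-refl
⟦a∧b⟧≤⟦b⟧ false b = z≤n

⟦a∧b⟧≤⟦a⟧ : ∀ a b → ⟦ a ∧ b ⟧ ≤ ⟦ a ⟧
⟦a∧b⟧≤⟦a⟧ a b = subst (_≤ ⟦ a ⟧) (cong ⟦_⟧ (∧-comm b a)) (⟦a∧b⟧≤⟦b⟧ b a)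

⟦a⟧*⟦b⟧*m≡⟦b∧a⟧*m : ∀ a b m → ⟦ a ⟧ * (⟦ b ⟧ * m) ≡ ⟦ b ∧ a ⟧ * m
⟦a⟧*⟦b⟧*m≡⟦b∧a⟧*m true  true  m = trans (+-identityʳ _) (trans (+-identityʳ _) (sym (+-identityʳ m)))
⟦a⟧*⟦b⟧*m≡⟦b∧a⟧*m true  false m = refl
⟦a⟧*⟦b⟧*m≡⟦b∧a⟧*m false true  m = refl
⟦a⟧*⟦b⟧*m≡⟦b∧a⟧*m false false m = refl

*-⟦⟧-mono-≤ : ∀ {m j} b → (b ≡ true → m ≤ j) → m * ⟦ b ⟧ ≤ j * ⟦ b ⟧
*-⟦⟧-mono-≤ true  m≤j = *-monoˡ-≤ 1 (m≤j refl)
*-⟦⟧-mono-≤ {m} {j} false _ = ≤-reflexive (trans (*-zeroʳ m) (sym (*-zeroʳ j)))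

*-⟦⟧-cong : ∀ {m j} b → (b ≡ true → m ≡ j) → m * ⟦ b ⟧ ≡ j * ⟦ b ⟧
*-⟦⟧-cong true  m≡j = cong (_* 1) (m≡j refl)
*-⟦⟧-cong {m} {j} false _ = trans (*-zeroʳ m) (sym (*-zeroʳ j))

⟦⟧*-mono-≤ : ∀ {m j} b → (b ≡ true → m ≤ j) → ⟦ b ⟧ * m ≤ ⟦ b ⟧ * j
⟦⟧*-mono-≤ true  m≤j = *-monoʳ-≤ 1 (m≤j refl)
⟦⟧*-mono-≤ false _   = z≤n

middle≤ : ∀ a b c → b ≤ a + b + c
middle≤ a b c = ≤-trans (m≤n+m b a) (m≤m+n (a + b) c)

∑-insert-∩ : ∀ n (W : Subset n) (g : Subset n → ℕ) →
  ∑[ S ← allSubsets n ] ∑[ w ← allVertices n ] (⟦ w ∈ᵇ W ⟧ * (⟦ not (w ∈ᵇ S) ⟧ * g (S ∪ ⁅ w ⁆)))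
    ≡ ∑[ T ← allSubsets n ] (∣ T ∩ W ∣ * g T)
∑-insert-∩ n W g = begin
  ∑[ S ← 𝒫 ] ∑[ w ← 𝒱 ] (⟦ w ∈ᵇ W ⟧ * (⟦ not (w ∈ᵇ S) ⟧ * g (S ∪ ⁅ w ⁆)))
    ≡⟨ ∑-comm 𝒫 𝒱 _ ⟩
  ∑[ w ← 𝒱 ] ∑[ S ← 𝒫 ] (⟦ w ∈ᵇ W ⟧ * (⟦ not (w ∈ᵇ S) ⟧ * g (S ∪ ⁅ w ⁆)))
    ≡⟨ ∑-cong 𝒱 (λ w → sym (*-distribˡ-∑ ⟦ w ∈ᵇ W ⟧ 𝒫 _)) ⟩
  ∑[ w ← 𝒱 ] (⟦ w ∈ᵇ W ⟧ * ∑[ S ← 𝒫 ] (⟦ not (w ∈ᵇ S) ⟧ * g (S ∪ ⁅ w ⁆)))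
    ≡⟨ ∑-cong 𝒱 (λ w → cong (⟦ w ∈ᵇ W ⟧ *_) (∑-insert n w g)) ⟩
  ∑[ w ← 𝒱 ] (⟦ w ∈ᵇ W ⟧ * ∑[ T ← 𝒫 ] (⟦ w ∈ᵇ T ⟧ * g T))
    ≡⟨ ∑-cong 𝒱 (λ w → *-distribˡ-∑ ⟦ w ∈ᵇ W ⟧ 𝒫 _) ⟩
  ∑[ w ← 𝒱 ] ∑[ T ← 𝒫 ] (⟦ w ∈ᵇ W ⟧ * (⟦ w ∈ᵇ T ⟧ * g T))
    ≡⟨ ∑-comm 𝒱 𝒫 _ ⟩
  ∑[ T ← 𝒫 ] ∑[ w ← 𝒱 ] (⟦ w ∈ᵇ W ⟧ * (⟦ w ∈ᵇ T ⟧ * g T))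
    ≡⟨ ∑-cong 𝒫 (λ T → ∑-cong 𝒱 (λ w → trans (⟦a⟧*⟦b⟧*m≡⟦b∧a⟧*m (w ∈ᵇ W) (w ∈ᵇ T) (g T))
                                           (cong (λ b → ⟦ b ⟧ * g T) (sym (∈ᵇ-∩ w T W))))) ⟩
  ∑[ T ← 𝒫 ] ∑[ w ← 𝒱 ] (⟦ w ∈ᵇ T ∩ W ⟧ * g T)
    ≡⟨ ∑-cong 𝒫 (λ T → trans (sym (*-distribʳ-∑ (g T) 𝒱 _)) (cong (_* g T) (sym (∣∣≡∑ (T ∩ W))))) ⟩
  ∑[ T ← 𝒫 ] (∣ T ∩ W ∣ * g T) ∎
  where
  open ≡-Reasoning
  𝒫 = allSubsets n
  𝒱 = allVertices n

data Class {n} (A B C : Subset n) (x : Fin n) : Set where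
  inA : x ∈ᵇ A ≡ true  → x ∈ᵇ B ≡ false → x ∈ᵇ C ≡ false → Class A B C x
  inB : x ∈ᵇ A ≡ false → x ∈ᵇ B ≡ true  → x ∈ᵇ C ≡ false → Class A B C x
  inC : x ∈ᵇ A ≡ false → x ∈ᵇ B ≡ false → x ∈ᵇ C ≡ true  → Class A B C x

Partition : ∀ {n} → Subset n → Subset n → Subset n → Set
Partition {n} A B C = (x : Fin n) → Class A B C x

module _ {n : ℕ} {A B C : Subset n} (partition : Partition A B C) where

  ∣∣-partition : ∣ A ∣ + ∣ B ∣ + ∣ C ∣ ≡ n
  ∣∣-partition = begin
    ∣ A ∣ + ∣ B ∣ + ∣ C ∣
      ≡⟨ cong₂ _+_ (cong₂ _+_ (∣∣≡∑ A) (∣∣≡∑ B)) (∣∣≡∑ C) ⟩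
    ∑ 𝒱 (⟦_⟧ ∘ (_∈ᵇ A)) + ∑ 𝒱 (⟦_⟧ ∘ (_∈ᵇ B)) + ∑ 𝒱 (⟦_⟧ ∘ (_∈ᵇ C))
      ≡⟨ cong (_+ ∑ 𝒱 (⟦_⟧ ∘ (_∈ᵇ C))) (∑-distrib-+ 𝒱 (⟦_⟧ ∘ (_∈ᵇ A)) (⟦_⟧ ∘ (_∈ᵇ B))) ⟨
    ∑[ x ← 𝒱 ] (⟦ x ∈ᵇ A ⟧ + ⟦ x ∈ᵇ B ⟧) + ∑ 𝒱 (⟦_⟧ ∘ (_∈ᵇ C))
      ≡⟨ ∑-distrib-+ 𝒱 (λ x → ⟦ x ∈ᵇ A ⟧ + ⟦ x ∈ᵇ B ⟧) (⟦_⟧ ∘ (_∈ᵇ C)) ⟨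
    ∑[ x ← 𝒱 ] (⟦ x ∈ᵇ A ⟧ + ⟦ x ∈ᵇ B ⟧ + ⟦ x ∈ᵇ C ⟧)
      ≡⟨ ∑-cong 𝒱 (λ x → one-class (partition x)) ⟩
    ∑[ x ← 𝒱 ] 1
      ≡⟨ trans (∑-1 𝒱) (List.length-tabulate (λ x → x)) ⟩
    n ∎
    where
    open ≡-Reasoning
    𝒱 = allVertices n
    one-class : ∀ {x} → Class A B C x → ⟦ x ∈ᵇ A ⟧ + ⟦ x ∈ᵇ B ⟧ + ⟦ x ∈ᵇ C ⟧ ≡ 1
    one-class (inA a b c) rewrite a | b | c = refl
    one-class (inB a b c) rewrite a | b | c = refl
    one-class (inC a b c) rewrite a | b | c = refl

  A∩C≡∅ : ∀ x → x ∈ᵇ A ≡ true → x ∈ᵇ C ≡ false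
  A∩C≡∅ x x∈A with partition x
  ... | inA _ _ x∉C = x∉C
  ... | inB x∉A _ _ with () ← trans (sym x∈A) x∉A
  ... | inC x∉A _ _ with () ← trans (sym x∈A) x∉A


module Counting {n : ℕ} (k : ℕ) (H : Hypergraph n) (uniform : Uniform k H) (C : Subset n) where

  private
    𝒫 = allSubsets n
    𝒱 = allVertices n

  cEdge : Fin n → Subset n → Bool
  cEdge v T = subsetOfSize C (k ∸ 1) T ∧ H (T ∪ ⁅ v ⁆)

  private
    removeVertex : ∀ v S → v ∈ᵇ C ≡ false →
      ⟦ not (v ∈ᵇ S) ⟧ * ⟦ H (S ∪ ⁅ v ⁆) ∧ ((S ∪ ⁅ v ⁆) ─ ⁅ v ⁆ ⊆ᵇ C) ⟧ ≡ ⟦ ((S ⊆ᵇ C) ∧ (∣ S ∣ ≡ᵇ k ∸ 1)) ∧ H (S ∪ ⁅ v ⁆) ⟧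
    removeVertex v S v∉C with v ∈ᵇ S in v∈S
    ... | true  rewrite ⊆ᵇ-false {p = S} {C} v v∈S v∉C = refl
    ... | false rewrite ∪⁅⁆─⁅⁆ S v v∈S with H (S ∪ ⁅ v ⁆) in edge
    ...   | false = cong ⟦_⟧ (sym (∧-zeroʳ _))
    ...   | true  rewrite ≡ᵇ-true (cong (_∸ 1) (trans (sym (∣∪⁅⁆∣ S v v∈S)) (uniform _ edge))) =
      trans (+-identityʳ _) (cong ⟦_⟧ (sym (trans (∧-identityʳ _) (∧-identityʳ (S ⊆ᵇ C)))))

  degC≡∑cEdge : ∀ v → v ∈ᵇ C ≡ false → degC H C v ≡ ∑[ T ← 𝒫 ] ⟦ cEdge v T ⟧
  degC≡∑cEdge v v∉C = begin
    degC H C v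
      ≡⟨ degC≡∑ H C v ⟩
    ∑[ e ← 𝒫 ] ⟦ H e ∧ ((v ∈ᵇ e) ∧ (e ─ ⁅ v ⁆ ⊆ᵇ C)) ⟧
      ≡⟨ ∑-cong 𝒫 (λ e → ⟦a∧[b∧c]⟧≡⟦b⟧*⟦a∧c⟧ (H e) (v ∈ᵇ e) _) ⟩
    ∑[ e ← 𝒫 ] (⟦ v ∈ᵇ e ⟧ * ⟦ H e ∧ (e ─ ⁅ v ⁆ ⊆ᵇ C) ⟧)
      ≡⟨ ∑-insert n v _ ⟨
    ∑[ S ← 𝒫 ] (⟦ not (v ∈ᵇ S) ⟧ * ⟦ H (S ∪ ⁅ v ⁆) ∧ ((S ∪ ⁅ v ⁆) ─ ⁅ v ⁆ ⊆ᵇ C) ⟧)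
      ≡⟨ ∑-cong 𝒫 (λ S → removeVertex v S v∉C) ⟩
    ∑[ T ← 𝒫 ] ⟦ cEdge v T ⟧ ∎
    where open ≡-Reasoning

  degC≤binom : ∀ v → v ∈ᵇ C ≡ false → degC H C v ≤ binom ∣ C ∣ (k ∸ 1)
  degC≤binom v v∉C = begin
    degC H C v                                ≡⟨ degC≡∑cEdge v v∉C ⟩
    ∑[ T ← 𝒫 ] ⟦ cEdge v T ⟧                  ≤⟨ ∑-mono-≤ 𝒫 (λ T → ⟦a∧b⟧≤⟦a⟧ _ (H (T ∪ ⁅ v ⁆))) ⟩
    ∑[ T ← 𝒫 ] ⟦ subsetOfSize C (k ∸ 1) T ⟧   ≡⟨ ∑-subsetOfSize C (k ∸ 1) ⟩
    binom ∣ C ∣ (k ∸ 1)                       ∎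
    where open ≤-Reasoning

  private
    pullOutside : ∀ x → ⟦ not (x ∈ᵇ C) ⟧ * degC H C x ≡ ⟦ not (x ∈ᵇ C) ⟧ * ∑[ S ← 𝒫 ] ⟦ cEdge x S ⟧
    pullOutside x with x ∈ᵇ C in x∈C
    ... | true  = refl
    ... | false = cong (1 *_) (degC≡∑cEdge x x∈C)

    cEdge-outside : Independent H C → ∀ x S →
      ⟦ not (x ∈ᵇ C) ⟧ * ⟦ ((S ⊆ᵇ C) ∧ (∣ S ∣ ≡ᵇ k ∸ 1)) ∧ H (S ∪ ⁅ x ⁆) ⟧
        ≡ ⟦ (S ⊆ᵇ C) ∧ (∣ S ∣ ≡ᵇ k ∸ 1) ⟧ * ⟦ not (x ∈ᵇ S) ∧ H (S ∪ ⁅ x ⁆) ⟧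
    cEdge-outside indep x S with S ⊆ᵇ C in S⊆C
    ... | false = *-zeroʳ ⟦ not (x ∈ᵇ C) ⟧
    ... | true with x ∈ᵇ C in x∈C
    ...   | true rewrite independent⇒¬edge {H = H} {e = S ∪ ⁅ x ⁆} indep (∪⁅⁆-⊆ᵇ S C x S⊆C x∈C)
                       | ∧-zeroʳ (not (x ∈ᵇ S)) = sym (*-zeroʳ ⟦ ∣ S ∣ ≡ᵇ k ∸ 1 ⟧)
    ...   | false rewrite ⊆ᵇ-∉ {p = S} S⊆C x x∈C = trans (+-identityʳ _) (⟦∧⟧ _ (H (S ∪ ⁅ x ⁆)))

  ∑-degC-outside : Independent H C →
    ∑[ x ← 𝒱 ] (⟦ not (x ∈ᵇ C) ⟧ * degC H C x) ≡ ∑[ S ← 𝒫 ] (⟦ subsetOfSize C (k ∸ 1) S ⟧ * codeg H S)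
  ∑-degC-outside indep = begin
    ∑[ x ← 𝒱 ] (⟦ not (x ∈ᵇ C) ⟧ * degC H C x)
      ≡⟨ ∑-cong 𝒱 pullOutside ⟩
    ∑[ x ← 𝒱 ] (⟦ not (x ∈ᵇ C) ⟧ * ∑[ S ← 𝒫 ] ⟦ cEdge x S ⟧)
      ≡⟨ ∑-cong 𝒱 (λ x → *-distribˡ-∑ ⟦ not (x ∈ᵇ C) ⟧ 𝒫 (⟦_⟧ ∘ cEdge x)) ⟩
    ∑[ x ← 𝒱 ] ∑[ S ← 𝒫 ] (⟦ not (x ∈ᵇ C) ⟧ * ⟦ cEdge x S ⟧)
      ≡⟨ ∑-comm 𝒱 𝒫 _ ⟩
    ∑[ S ← 𝒫 ] ∑[ x ← 𝒱 ] (⟦ not (x ∈ᵇ C) ⟧ * ⟦ cEdge x S ⟧)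
      ≡⟨ ∑-cong 𝒫 (λ S → ∑-cong 𝒱 (λ x → cEdge-outside indep x S)) ⟩
    ∑[ S ← 𝒫 ] ∑[ x ← 𝒱 ] (⟦ subsetOfSize C (k ∸ 1) S ⟧ * ⟦ not (x ∈ᵇ S) ∧ H (S ∪ ⁅ x ⁆) ⟧)
      ≡⟨ ∑-cong 𝒫 (λ S → trans (sym (*-distribˡ-∑ ⟦ subsetOfSize C (k ∸ 1) S ⟧ 𝒱 _))
                                   (cong (⟦ subsetOfSize C (k ∸ 1) S ⟧ *_) (sym (codeg≡∑ H S)))) ⟩
    ∑[ S ← 𝒫 ] (⟦ subsetOfSize C (k ∸ 1) S ⟧ * codeg H S) ∎
    where open ≡-Reasoning

  module _ {A B : Subset n} (partition : Partition A B C) where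

    slack : Fin n → ℕ
    slack x = binom (∣ C ∣) (k ∸ 1) ∸ degC H C x

    degree-budget : ∑[ x ← 𝒱 ] (⟦ not (x ∈ᵇ C) ⟧ * degC H C x) + ∑[ x ← 𝒱 ] (⟦ x ∈ᵇ B ⟧ * slack x)
                    ≤ binom (∣ C ∣) (k ∸ 1) * ∣ A ∣ + binom (∣ C ∣) (k ∸ 1) * ∣ B ∣
    degree-budget = begin
      ∑[ x ← 𝒱 ] (⟦ not (x ∈ᵇ C) ⟧ * degC H C x) + ∑[ x ← 𝒱 ] (⟦ x ∈ᵇ B ⟧ * slack x)
        ≡⟨ ∑-distrib-+ 𝒱 _ _ ⟨
      ∑[ x ← 𝒱 ] (⟦ not (x ∈ᵇ C) ⟧ * degC H C x + ⟦ x ∈ᵇ B ⟧ * slack x)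
        ≤⟨ ∑-mono-≤ 𝒱 (λ x → pointwise (partition x)) ⟩
      ∑[ x ← 𝒱 ] (M * ⟦ x ∈ᵇ A ⟧ + M * ⟦ x ∈ᵇ B ⟧)
        ≡⟨ ∑-distrib-+ 𝒱 _ _ ⟩
      ∑[ x ← 𝒱 ] (M * ⟦ x ∈ᵇ A ⟧) + ∑[ x ← 𝒱 ] (M * ⟦ x ∈ᵇ B ⟧)
        ≡⟨ cong₂ _+_ (trans (sym (*-distribˡ-∑ M 𝒱 _)) (cong (M *_) (sym (∣∣≡∑ A))))
                     (trans (sym (*-distribˡ-∑ M 𝒱 _)) (cong (M *_) (sym (∣∣≡∑ B)))) ⟩
      M * ∣ A ∣ + M * ∣ B ∣ ∎
      where
      open ≤-Reasoning
      M = binom (∣ C ∣) (k ∸ 1)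
      pointwise : ∀ {x} → Class A B C x → ⟦ not (x ∈ᵇ C) ⟧ * degC H C x + ⟦ x ∈ᵇ B ⟧ * slack x ≤ M * ⟦ x ∈ᵇ A ⟧ + M * ⟦ x ∈ᵇ B ⟧
      pointwise {x} (inA x∈A x∉B x∉C) rewrite x∈A | x∉B | x∉C = begin
        1 * degC H C x + 0 ≡⟨ trans (+-identityʳ _) (*-identityˡ _) ⟩
        degC H C x         ≤⟨ degC≤binom x x∉C ⟩
        M                  ≡⟨ trans (cong₂ _+_ (*-identityʳ M) (*-zeroʳ M)) (+-identityʳ M) ⟨
        M * 1 + M * 0      ∎
      pointwise {x} (inB x∉A x∈B x∉C) rewrite x∉A | x∈B | x∉C = begin
        1 * degC H C x + 1 * slack x ≡⟨ cong₂ _+_ (*-identityˡ (degC H C x)) (*-identityˡ (slack x)) ⟩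
        degC H C x + slack x         ≡⟨ m+[n∸m]≡n (degC≤binom x x∉C) ⟩
        M                            ≡⟨ cong₂ _+_ (*-zeroʳ M) (*-identityʳ M) ⟨
        M * 0 + M * 1                ∎
      pointwise {x} (inC x∉A x∉B x∈C) rewrite x∉A | x∉B | x∈C = z≤n

    aEdge : Fin n → Subset n → Bool
    aEdge v T = (∣ T ∣ ≡ᵇ k ∸ 1) ∧ (H (T ∪ ⁅ v ⁆) ∧ ((∣ T ∩ A ∣ ≡ᵇ 1) ∧ (∣ T ∩ C ∣ ≡ᵇ k ∸ 2)))

    module _ (k≥2 : 2 ≤ k) (v : Fin n) where

      private
        edge : Subset n → Fin n → Bool
        edge S w = H ((S ∪ ⁅ v ⁆) ∪ ⁅ w ⁆)

        ∪-swap : ∀ (S : Subset n) w → (S ∪ ⁅ w ⁆) ∪ ⁅ v ⁆ ≡ (S ∪ ⁅ v ⁆) ∪ ⁅ w ⁆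
        ∪-swap S w = trans (∪-assoc S ⁅ w ⁆ ⁅ v ⁆) (trans (cong (S ∪_) (∪-comm ⁅ w ⁆ ⁅ v ⁆)) (sym (∪-assoc S ⁅ v ⁆ ⁅ w ⁆)))

        ∣∪⁅⁆∣≡k∸1 : ∀ (S : Subset n) w → ∣ S ∣ ≡ k ∸ 2 → w ∈ᵇ S ≡ false → ∣ S ∪ ⁅ w ⁆ ∣ ≡ k ∸ 1
        ∣∪⁅⁆∣≡k∸1 S w ∣S∣ w∉S = trans (∣∪⁅⁆∣ S w w∉S) (trans (cong suc ∣S∣) (sym (+-∸-assoc 1 k≥2)))

        cEdge-via-C : ∀ (S : Subset n) w → subsetOfSize C (k ∸ 2) S ≡ true → w ∈ᵇ C ≡ true → w ∈ᵇ S ≡ false →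
                      cEdge v (S ∪ ⁅ w ⁆) ≡ edge S w
        cEdge-via-C S w ι w∈C w∉S =
          cong₂ _∧_ (cong₂ _∧_ (∪⁅⁆-⊆ᵇ S C w (proj₁ (subsetOfSize-true C (k ∸ 2) S ι)) w∈C)
                               (≡ᵇ-true (∣∪⁅⁆∣≡k∸1 S w (proj₂ (subsetOfSize-true C (k ∸ 2) S ι)) w∉S)))
                    (cong H (∪-swap S w))

        aEdge-via-A : ∀ (S : Subset n) w → subsetOfSize C (k ∸ 2) S ≡ true → w ∈ᵇ A ≡ true → w ∈ᵇ S ≡ false →
                      aEdge v (S ∪ ⁅ w ⁆) ≡ edge S w
        aEdge-via-A S w ι w∈A w∉S = begin
          aEdge v (S ∪ ⁅ w ⁆)
            ≡⟨ cong₂ _∧_ (≡ᵇ-true (∣∪⁅⁆∣≡k∸1 S w ∣S∣ w∉S))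
                 (cong₂ _∧_ (cong H (∪-swap S w))
                   (cong₂ _∧_ (≡ᵇ-true (trans (cong ∣_∣ (∪⁅⁆∩-disjoint S C A w S⊆C w∈A (A∩C≡∅ partition))) (∣⁅x⁆∣≡1 w)))
                              (≡ᵇ-true (trans (cong ∣_∣ (∪⁅⁆∩-⊆ S C w S⊆C (A∩C≡∅ partition w w∈A))) ∣S∣)))) ⟩
          edge S w ∧ true
            ≡⟨ ∧-identityʳ (edge S w) ⟩
          edge S w ∎
          where
          open ≡-Reasoning
          S⊆C = proj₁ (subsetOfSize-true C (k ∸ 2) S ι)
          ∣S∣ = proj₂ (subsetOfSize-true C (k ∸ 2) S ι)

        viaC viaA : Subset n → Fin n → ℕ
        viaC S w = ⟦ w ∈ᵇ C ⟧ * (⟦ not (w ∈ᵇ S) ⟧ * ⟦ cEdge v (S ∪ ⁅ w ⁆) ⟧)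
        viaA S w = ⟦ w ∈ᵇ A ⟧ * (⟦ not (w ∈ᵇ S) ⟧ * ⟦ aEdge v (S ∪ ⁅ w ⁆) ⟧)

        -- The third vertex w of an edge through S ∪ {v} lies in C, A or B; in the first two cases
        -- S ∪ {w} is counted by deg(v, C), resp. deg(v, AC^{k-2}).
        link-split : ∀ S w →
          ⟦ subsetOfSize C (k ∸ 2) S ⟧ * ⟦ not (w ∈ᵇ S ∪ ⁅ v ⁆) ∧ edge S w ⟧
            ≤ viaC S w + viaA S w + ⟦ subsetOfSize C (k ∸ 2) S ⟧ * ⟦ w ∈ᵇ B ⟧
        link-split S w with subsetOfSize C (k ∸ 2) S in ι | partition w
        ... | false | _ = z≤n
        ... | true  | inB _ w∈B _ = ≤-trans bound (m≤n+m (1 * ⟦ w ∈ᵇ B ⟧) (viaC S w + viaA S w))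
          where
          bound : 1 * ⟦ not (w ∈ᵇ S ∪ ⁅ v ⁆) ∧ edge S w ⟧ ≤ 1 * ⟦ w ∈ᵇ B ⟧
          bound = *-monoʳ-≤ 1 (subst (λ b → ⟦ not (w ∈ᵇ S ∪ ⁅ v ⁆) ∧ edge S w ⟧ ≤ ⟦ b ⟧) (sym w∈B) (⟦⟧≤1 _))
        ... | true  | inA w∈A _ w∉C = ≤-trans bound (middle≤ (viaC S w) (viaA S w) (1 * ⟦ w ∈ᵇ B ⟧))
          where
          open ≤-Reasoning
          w∉S = ⊆ᵇ-∉ {p = S} (proj₁ (subsetOfSize-true C (k ∸ 2) S ι)) w w∉C
          bound : 1 * ⟦ not (w ∈ᵇ S ∪ ⁅ v ⁆) ∧ edge S w ⟧ ≤ viaA S w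
          bound = begin
            1 * ⟦ not (w ∈ᵇ S ∪ ⁅ v ⁆) ∧ edge S w ⟧ ≤⟨ ≤-trans (≤-reflexive (*-identityˡ _)) (⟦a∧b⟧≤⟦b⟧ _ (edge S w)) ⟩
            ⟦ edge S w ⟧                             ≡⟨ cong ⟦_⟧ (aEdge-via-A S w ι w∈A w∉S) ⟨
            ⟦ aEdge v (S ∪ ⁅ w ⁆) ⟧                  ≡⟨ trans (*-identityˡ _) (*-identityˡ _) ⟨
            1 * (1 * ⟦ aEdge v (S ∪ ⁅ w ⁆) ⟧)
              ≡⟨ cong₂ (λ a s → ⟦ a ⟧ * (⟦ not s ⟧ * ⟦ aEdge v (S ∪ ⁅ w ⁆) ⟧)) w∈A w∉S ⟨
            viaA S w                                 ∎
        ... | true  | inC _ _ w∈C = byMembership (w ∈ᵇ S) refl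
          where
          open ≤-Reasoning
          RHS = viaC S w + viaA S w + 1 * ⟦ w ∈ᵇ B ⟧
          byMembership : ∀ s → w ∈ᵇ S ≡ s → 1 * ⟦ not (w ∈ᵇ S ∪ ⁅ v ⁆) ∧ edge S w ⟧ ≤ RHS
          byMembership true w∈S = subst (λ b → 1 * ⟦ not b ∧ edge S w ⟧ ≤ RHS)
                                        (sym (trans (∈ᵇ-∪ w S ⁅ v ⁆) (cong (_∨ (w ∈ᵇ ⁅ v ⁆)) w∈S))) z≤n
          byMembership false w∉S = begin
            1 * ⟦ not (w ∈ᵇ S ∪ ⁅ v ⁆) ∧ edge S w ⟧ ≤⟨ ≤-trans (≤-reflexive (*-identityˡ _)) (⟦a∧b⟧≤⟦b⟧ _ (edge S w)) ⟩
            ⟦ edge S w ⟧                             ≡⟨ cong ⟦_⟧ (cEdge-via-C S w ι w∈C w∉S) ⟨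
            ⟦ cEdge v (S ∪ ⁅ w ⁆) ⟧                  ≡⟨ trans (*-identityˡ _) (*-identityˡ _) ⟨
            1 * (1 * ⟦ cEdge v (S ∪ ⁅ w ⁆) ⟧)
              ≡⟨ cong₂ (λ c s → ⟦ c ⟧ * (⟦ not s ⟧ * ⟦ cEdge v (S ∪ ⁅ w ⁆) ⟧)) w∈C w∉S ⟨
            viaC S w                                 ≤⟨ ≤-trans (m≤m+n (viaC S w) (viaA S w)) (m≤m+n _ (1 * ⟦ w ∈ᵇ B ⟧)) ⟩
            RHS                                      ∎

        viaC-total : v ∈ᵇ C ≡ false → ∑[ S ← 𝒫 ] ∑ 𝒱 (viaC S) ≤ (k ∸ 1) * degC H C v
        viaC-total v∉C = begin
          ∑[ S ← 𝒫 ] ∑ 𝒱 (viaC S)               ≡⟨ ∑-insert-∩ n C (⟦_⟧ ∘ cEdge v) ⟩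
          ∑[ T ← 𝒫 ] (∣ T ∩ C ∣ * ⟦ cEdge v T ⟧)  ≤⟨ ∑-mono-≤ 𝒫 (λ T → *-⟦⟧-mono-≤ (cEdge v T) (∣T∩C∣≤k∸1 T)) ⟩
          ∑[ T ← 𝒫 ] ((k ∸ 1) * ⟦ cEdge v T ⟧)   ≡⟨ *-distribˡ-∑ (k ∸ 1) 𝒫 _ ⟨
          (k ∸ 1) * ∑[ T ← 𝒫 ] ⟦ cEdge v T ⟧      ≡⟨ cong ((k ∸ 1) *_) (degC≡∑cEdge v v∉C) ⟨
          (k ∸ 1) * degC H C v                   ∎
          where
          open ≤-Reasoning
          ∣T∩C∣≤k∸1 : ∀ T → cEdge v T ≡ true → ∣ T ∩ C ∣ ≤ k ∸ 1
          ∣T∩C∣≤k∸1 T e = ≤-trans (∣p∩q∣≤∣p∣ T C)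
            (≤-reflexive (proj₂ (subsetOfSize-true C (k ∸ 1) T (proj₁ (∧-true (subsetOfSize C (k ∸ 1) T) e)))))

        viaA-total : ∑[ S ← 𝒫 ] ∑ 𝒱 (viaA S) ≡ degAC k H A C v
        viaA-total = begin
          ∑[ S ← 𝒫 ] ∑ 𝒱 (viaA S)                ≡⟨ ∑-insert-∩ n A (⟦_⟧ ∘ aEdge v) ⟩
          ∑[ T ← 𝒫 ] (∣ T ∩ A ∣ * ⟦ aEdge v T ⟧)  ≡⟨ ∑-cong 𝒫 (λ T → trans (*-⟦⟧-cong (aEdge v T) (∣T∩A∣≡1 T)) (*-identityˡ _)) ⟩
          ∑[ T ← 𝒫 ] ⟦ aEdge v T ⟧               ≡⟨ degAC≡∑ H k A C v ⟨
          degAC k H A C v                        ∎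
          where
          open ≡-Reasoning
          ∣T∩A∣≡1 : ∀ T → aEdge v T ≡ true → ∣ T ∩ A ∣ ≡ 1
          ∣T∩A∣≡1 T e = ≡ᵇ-true⁻¹ (proj₁ (∧-true (∣ T ∩ A ∣ ≡ᵇ 1)
                          (proj₂ (∧-true (H (T ∪ ⁅ v ⁆)) (proj₂ (∧-true (∣ T ∣ ≡ᵇ k ∸ 1) e))))))

        viaB-total : ∑[ S ← 𝒫 ] ∑[ w ← 𝒱 ] (⟦ subsetOfSize C (k ∸ 2) S ⟧ * ⟦ w ∈ᵇ B ⟧) ≡ binom (∣ C ∣) (k ∸ 2) * ∣ B ∣
        viaB-total = begin
          ∑[ S ← 𝒫 ] ∑[ w ← 𝒱 ] (⟦ ι S ⟧ * ⟦ w ∈ᵇ B ⟧)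
            ≡⟨ ∑-cong 𝒫 (λ S → trans (sym (*-distribˡ-∑ ⟦ ι S ⟧ 𝒱 _)) (cong (⟦ ι S ⟧ *_) (sym (∣∣≡∑ B)))) ⟩
          ∑[ S ← 𝒫 ] (⟦ ι S ⟧ * ∣ B ∣)              ≡⟨ *-distribʳ-∑ ∣ B ∣ 𝒫 _ ⟨
          ∑[ S ← 𝒫 ] ⟦ ι S ⟧ * ∣ B ∣                ≡⟨ cong (λ x → x * ∣ B ∣) (∑-subsetOfSize C (k ∸ 2)) ⟩
          binom (∣ C ∣) (k ∸ 2) * ∣ B ∣             ∎
          where
          open ≡-Reasoning
          ι = subsetOfSize C (k ∸ 2)

      ∑-codeg-link : v ∈ᵇ C ≡ false →
        ∑[ S ← 𝒫 ] (⟦ subsetOfSize C (k ∸ 2) S ⟧ * codeg H (S ∪ ⁅ v ⁆))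
          ≤ (k ∸ 1) * degC H C v + degAC k H A C v + binom (∣ C ∣) (k ∸ 2) * ∣ B ∣
      ∑-codeg-link v∉C = begin
        ∑[ S ← 𝒫 ] (⟦ ι S ⟧ * codeg H (S ∪ ⁅ v ⁆))
          ≡⟨ ∑-cong 𝒫 (λ S → trans (cong (⟦ ι S ⟧ *_) (codeg≡∑ H (S ∪ ⁅ v ⁆))) (*-distribˡ-∑ ⟦ ι S ⟧ 𝒱 _)) ⟩
        ∑[ S ← 𝒫 ] ∑[ w ← 𝒱 ] (⟦ ι S ⟧ * ⟦ not (w ∈ᵇ S ∪ ⁅ v ⁆) ∧ edge S w ⟧)
          ≤⟨ ∑-mono-≤ 𝒫 (λ S → ∑-mono-≤ 𝒱 (link-split S)) ⟩
        ∑[ S ← 𝒫 ] ∑[ w ← 𝒱 ] (viaC S w + viaA S w + ⟦ ι S ⟧ * ⟦ w ∈ᵇ B ⟧)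
          ≡⟨ trans (∑∑-distrib-+ 𝒫 𝒱 (λ S w → viaC S w + viaA S w) _)
                   (cong (_+ ∑[ S ← 𝒫 ] ∑[ w ← 𝒱 ] (⟦ ι S ⟧ * ⟦ w ∈ᵇ B ⟧)) (∑∑-distrib-+ 𝒫 𝒱 viaC viaA)) ⟩
        ∑[ S ← 𝒫 ] ∑ 𝒱 (viaC S) + ∑[ S ← 𝒫 ] ∑ 𝒱 (viaA S) + ∑[ S ← 𝒫 ] ∑[ w ← 𝒱 ] (⟦ ι S ⟧ * ⟦ w ∈ᵇ B ⟧)
          ≤⟨ +-mono-≤ (+-mono-≤ (viaC-total v∉C) (≤-reflexive viaA-total)) (≤-reflexive viaB-total) ⟩
        (k ∸ 1) * degC H C v + degAC k H A C v + binom (∣ C ∣) (k ∸ 2) * ∣ B ∣ ∎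
        where
        open ≤-Reasoning
        ι = subsetOfSize C (k ∸ 2)

module _ {n : ℕ} (k : ℕ) (ε : ℚ) (H : Hypergraph n) (C : Subset n) where

  private
    A = Aset k ε H C
    B = Bset k ε H C

    ∈A : ∀ x → x ∈ᵇ A ≡ not (x ∈ᵇ C) ∧ does (highDeg? ε (binom ∣ C ∣ (k ∸ 1)) (degC H C x))
    ∈A x = ∈ᵇ-tabulate _ x

    ∈B : ∀ x → x ∈ᵇ B ≡ not ((x ∈ᵇ A) ∨ (x ∈ᵇ C))
    ∈B x = trans (∈ᵇ-tabulate _ x) (cong not (∈ᵇ-∪ x A C))

  ABC-partition : Partition A B C
  ABC-partition x = classify (x ∈ᵇ C) refl _ refl
    where
    classify : ∀ c → x ∈ᵇ C ≡ c → ∀ h → does (highDeg? ε (binom ∣ C ∣ (k ∸ 1)) (degC H C x)) ≡ h → Class A B C x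
    classify true  x∈C h     hx = inC x∉A (trans (∈B x) (cong₂ (λ a c → not (a ∨ c)) x∉A x∈C)) x∈C
      where x∉A = trans (∈A x) (cong₂ (λ c h → not c ∧ h) x∈C hx)
    classify false x∉C true  hx = inA x∈A (trans (∈B x) (cong₂ (λ a c → not (a ∨ c)) x∈A x∉C)) x∉C
      where x∈A = trans (∈A x) (cong₂ (λ c h → not c ∧ h) x∉C hx)
    classify false x∉C false hx = inB x∉A (trans (∈B x) (cong₂ (λ a c → not (a ∨ c)) x∉A x∉C)) x∉C
      where x∉A = trans (∈A x) (cong₂ (λ c h → not c ∧ h) x∉C hx)

  Bset⇒¬HighDeg : ∀ x → x ∈ᵇ B ≡ true → ¬ HighDeg ε (binom ∣ C ∣ (k ∸ 1)) (degC H C x)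
  Bset⇒¬HighDeg x x∈B = byClass (ABC-partition x)
    where
    -- Matching on the class instead of using `with` avoids normalising the rational inequality
    -- HighDeg, which is prohibitively expensive.
    byClass : Class A B C x → ¬ HighDeg ε (binom ∣ C ∣ (k ∸ 1)) (degC H C x)
    byClass (inA _ x∉B _)   = ⊥-elim (true≢false (trans (sym x∈B) x∉B))
    byClass (inC _ x∉B _)   = ⊥-elim (true≢false (trans (sym x∈B) x∉B))
    byClass (inB x∉A _ x∉C) = does-false (highDeg? ε (binom ∣ C ∣ (k ∸ 1)) (degC H C x))
                                (outside-∧ x∉C (trans (sym (∈A x)) x∉A))
      where
      outside-∧ : ∀ {c h} → c ≡ false → not c ∧ h ≡ false → h ≡ false
      outside-∧ refl h≡false = h≡false

  Bset⇒∉C : ∀ x → x ∈ᵇ B ≡ true → x ∈ᵇ C ≡ false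
  Bset⇒∉C x x∈B = byClass (ABC-partition x)
    where
    byClass : Class A B C x → x ∈ᵇ C ≡ false
    byClass (inA _ x∉B _) = ⊥-elim (true≢false (trans (sym x∈B) x∉B))
    byClass (inC _ x∉B _) = ⊥-elim (true≢false (trans (sym x∈B) x∉B))
    byClass (inB _ _ x∉C) = x∉C

─∅ : ∀ {n} (P : Subset n) → P ─ ∅ ≡ P
─∅ P = Subset-ext λ x → trans (∈ᵇ-─ x P ∅) (trans (cong (λ b → (x ∈ᵇ P) ∧ not b) (∈ᵇ-∅ x)) (∧-identityʳ _))

∣─⁅⁆∣ : ∀ {n} (P : Subset n) y → y ∈ᵇ P ≡ true → suc ∣ P ─ ⁅ y ⁆ ∣ ≡ ∣ P ∣
∣─⁅⁆∣ (true  ∷ P) zero    _   = cong (suc ∘ ∣_∣) (─∅ P)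
∣─⁅⁆∣ (true  ∷ P) (suc y) y∈P = cong suc (∣─⁅⁆∣ P y y∈P)
∣─⁅⁆∣ (false ∷ P) (suc y) y∈P = ∣─⁅⁆∣ P y y∈P

length≤∣∣ : ∀ {n} (vs : List (Fin n)) (P : Subset n) → Unique vs → (∀ x → x ∈ˡ vs → x ∈ᵇ P ≡ true) → length vs ≤ ∣ P ∣
length≤∣∣ []       P _            _    = z≤n
length≤∣∣ (y ∷ ys) P (y∉ys ∷ uniq) ys⊆P = subst (length (y ∷ ys) ≤_) (∣─⁅⁆∣ P y (ys⊆P y (here refl)))
  (s≤s (length≤∣∣ ys (P ─ ⁅ y ⁆) uniq ys⊆P─y))
  where
  ys⊆P─y : ∀ x → x ∈ˡ ys → x ∈ᵇ P ─ ⁅ y ⁆ ≡ true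
  ys⊆P─y x x∈ys = begin
    x ∈ᵇ P ─ ⁅ y ⁆                 ≡⟨ ∈ᵇ-─ x P ⁅ y ⁆ ⟩
    (x ∈ᵇ P) ∧ not (x ∈ᵇ ⁅ y ⁆)
      ≡⟨ cong₂ (λ a b → a ∧ not b) (ys⊆P x (there x∈ys)) (x∉ᵇ⁅y⁆ (λ x≡y → All.lookup y∉ys x∈ys (sym x≡y))) ⟩
    true                           ∎
    where open ≡-Reasoning

lookup∈take : ∀ (xs : List X) d (i : Fin (length xs)) → toℕ i < d → lookup xs i ∈ˡ take d xs
lookup∈take (x ∷ xs) (suc d) zero    _         = here refl
lookup∈take (x ∷ xs) (suc d) (suc i) (s≤s i<d) = there (lookup∈take xs d i i<d)

∉D⇒degC≤ : ∀ {n} k c (H : Hypergraph n) C vs d → IsD k c H C vs d → ∀ {v} → v ∈ˡ vs → ¬ (v ∈ˡ Dlist vs d) →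
           degC H C v ≤ (length vs + c) * (k ∸ 1) * binom ∣ C ∣ (k ∸ 2)
∉D⇒degC≤ k c H C vs d isD {v} v∈vs v∉D = begin
  degC H C v                                         ≡⟨ cong (degC H C) (lookup-index v∈vs) ⟩
  degC H C (lookup vs i)                             ≤⟨ ≮⇒≥ (notD isD) ⟩
  (toℕ i + 1 + c) * (k ∸ 1) * binom (∣ C ∣) (k ∸ 2)   ≤⟨ *-monoˡ-≤ _ (*-monoˡ-≤ (k ∸ 1) (+-monoˡ-≤ c i+1≤len)) ⟩
  (length vs + c) * (k ∸ 1) * binom (∣ C ∣) (k ∸ 2)   ∎
  where
  open ≤-Reasoning
  i = Any.index v∈vs
  i+1≤len : toℕ i + 1 ≤ length vs
  i+1≤len = subst (_≤ length vs) (+-comm 1 (toℕ i)) (toℕ<n i)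
  d≤i : d ≤ toℕ i
  d≤i with d ≤? toℕ i
  ... | yes d≤i = d≤i
  ... | no  d≰i = ⊥-elim (v∉D (subst (_∈ˡ take d vs) (sym (lookup-index v∈vs)) (lookup∈take vs d i (≰⇒> d≰i))))
  notD : IsD k c H C vs d → ¬ DCond k c H C vs i
  notD (inj₁ (_ , none))              = none i
  notD (inj₂ (j , d≡j+1 , _ , later)) = later i (subst (_≤ toℕ i) (trans d≡j+1 (+-comm (toℕ j) 1)) d≤i)

ℕ→ℚ≡mkℚ : ∀ a → ℕ→ℚ a ≡ mkℚ (ℤ.+ a) 0 (Coprimality.sym (1-coprimeTo a))
ℕ→ℚ≡mkℚ a = ℚₚ.normalize-coprime (Coprimality.sym (1-coprimeTo a))

toℚᵘ-ℕ→ℚ : ∀ a → ℚ.toℚᵘ (ℕ→ℚ a) ≡ ℚᵘ.mkℚᵘ (ℤ.+ a) 0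
toℚᵘ-ℕ→ℚ a rewrite ℕ→ℚ≡mkℚ a = refl

ℕ→ℚ-nonNeg : ∀ a → ℚ.NonNegative (ℕ→ℚ a)
ℕ→ℚ-nonNeg a rewrite ℕ→ℚ≡mkℚ a = _

ℕ→ℚ-pos : ∀ a → ℚ.Positive (ℕ→ℚ (suc a))
ℕ→ℚ-pos a rewrite ℕ→ℚ≡mkℚ (suc a) = _

ℕ→ℚ-cancel-≤ : ∀ {a b} → ℕ→ℚ a ≤ℚ ℕ→ℚ b → a ≤ b
ℕ→ℚ-cancel-≤ {a} {b} a≤b with ℚₚ.toℚᵘ-mono-≤ a≤b
... | a≤ᵘb rewrite toℚᵘ-ℕ→ℚ a | toℚᵘ-ℕ→ℚ b with a≤ᵘb
... | ℚᵘ.*≤* a≤b′ rewrite ℤₚ.*-identityʳ (ℤ.+ a) | ℤₚ.*-identityʳ (ℤ.+ b) = ℤₚ.drop‿+≤+ a≤b′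

ℕ→ℚ-cancel-< : ∀ {a b} → ℕ→ℚ a <ℚ ℕ→ℚ b → a < b
ℕ→ℚ-cancel-< {a} {b} a<b with ℚₚ.toℚᵘ-mono-< a<b
... | a<ᵘb rewrite toℚᵘ-ℕ→ℚ a | toℚᵘ-ℕ→ℚ b with a<ᵘb
... | ℚᵘ.*<* a<b′ rewrite ℤₚ.*-identityʳ (ℤ.+ a) | ℤₚ.*-identityʳ (ℤ.+ b) = ℤₚ.drop‿+<+ a<b′

ℕ→ℚ-homo : ∀ (_∙_ : ℕ → ℕ → ℕ) (_∙ℚ_ : ℚ → ℚ → ℚ) (_∙ᵘ_ : ℚᵘ.ℚᵘ → ℚᵘ.ℚᵘ → ℚᵘ.ℚᵘ) →
           (∀ p q → ℚ.toℚᵘ (p ∙ℚ q) ℚᵘ.≃ (ℚ.toℚᵘ p ∙ᵘ ℚ.toℚᵘ q)) →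
           (∀ a b → ℚᵘ.mkℚᵘ (ℤ.+ (a ∙ b)) 0 ℚᵘ.≃ (ℚᵘ.mkℚᵘ (ℤ.+ a) 0 ∙ᵘ ℚᵘ.mkℚᵘ (ℤ.+ b) 0)) →
           ∀ a b → ℕ→ℚ (a ∙ b) ≡ ℕ→ℚ a ∙ℚ ℕ→ℚ b
ℕ→ℚ-homo _∙_ _∙ℚ_ _∙ᵘ_ toℚᵘ-homo homoᵘ a b = ℚₚ.toℚᵘ-injective (begin
  ℚ.toℚᵘ (ℕ→ℚ (a ∙ b))                    ≡⟨ toℚᵘ-ℕ→ℚ (a ∙ b) ⟩
  ℚᵘ.mkℚᵘ (ℤ.+ (a ∙ b)) 0                   ≈⟨ homoᵘ a b ⟩
  ℚᵘ.mkℚᵘ (ℤ.+ a) 0 ∙ᵘ ℚᵘ.mkℚᵘ (ℤ.+ b) 0      ≡⟨ cong₂ _∙ᵘ_ (toℚᵘ-ℕ→ℚ a) (toℚᵘ-ℕ→ℚ b) ⟨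
  ℚ.toℚᵘ (ℕ→ℚ a) ∙ᵘ ℚ.toℚᵘ (ℕ→ℚ b)        ≈⟨ toℚᵘ-homo (ℕ→ℚ a) (ℕ→ℚ b) ⟨
  ℚ.toℚᵘ (ℕ→ℚ a ∙ℚ ℕ→ℚ b)                  ∎)
  where open ℚᵘₚ.≃-Reasoning

ℕ→ℚ-+ : ∀ a b → ℕ→ℚ (a + b) ≡ ℕ→ℚ a ℚ.+ ℕ→ℚ b
ℕ→ℚ-+ = ℕ→ℚ-homo _+_ ℚ._+_ ℚᵘ._+_ ℚₚ.toℚᵘ-homo-+
  (λ a b → ℚᵘ.*≡* (cong (ℤ._* ℤ.+ 1) (trans (ℤₚ.pos-+ a b) (sym (cong₂ ℤ._+_ (ℤₚ.*-identityʳ (ℤ.+ a)) (ℤₚ.*-identityʳ (ℤ.+ b)))))))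

ℕ→ℚ-* : ∀ a b → ℕ→ℚ (a * b) ≡ ℕ→ℚ a *ℚ ℕ→ℚ b
ℕ→ℚ-* = ℕ→ℚ-homo _*_ _*ℚ_ ℚᵘ._*_ ℚₚ.toℚᵘ-homo-* (λ a b → ℚᵘ.*≡* (cong (ℤ._* ℤ.+ 1) (ℤₚ.pos-* a b)))

ℕ→ℚ-cube : ∀ a → ℕ→ℚ (a * a * a) ≡ ℕ→ℚ a *ℚ ℕ→ℚ a *ℚ ℕ→ℚ a
ℕ→ℚ-cube a = trans (ℕ→ℚ-* (a * a) a) (cong (_*ℚ ℕ→ℚ a) (ℕ→ℚ-* a a))

denominator*mkℚ : ∀ p d .(cop : Coprime p (suc d)) → ℕ→ℚ (suc d) *ℚ mkℚ (ℤ.+ p) d cop ≡ ℕ→ℚ p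
denominator*mkℚ p d cop = ℚₚ.toℚᵘ-injective (begin
  ℚ.toℚᵘ (ℕ→ℚ (suc d) *ℚ mkℚ (ℤ.+ p) d cop)          ≈⟨ ℚₚ.toℚᵘ-homo-* (ℕ→ℚ (suc d)) (mkℚ (ℤ.+ p) d cop) ⟩
  ℚ.toℚᵘ (ℕ→ℚ (suc d)) ℚᵘ.* ℚᵘ.mkℚᵘ (ℤ.+ p) d        ≡⟨ cong (ℚᵘ._* ℚᵘ.mkℚᵘ (ℤ.+ p) d) (toℚᵘ-ℕ→ℚ (suc d)) ⟩
  ℚᵘ.mkℚᵘ (ℤ.+ suc d) 0 ℚᵘ.* ℚᵘ.mkℚᵘ (ℤ.+ p) d       ≈⟨ ℚᵘ.*≡* cross ⟩
  ℚᵘ.mkℚᵘ (ℤ.+ p) 0                                  ≡⟨ toℚᵘ-ℕ→ℚ p ⟨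
  ℚ.toℚᵘ (ℕ→ℚ p)                                     ∎)
  where
  open ℚᵘₚ.≃-Reasoning
  cross : (ℤ.+ suc d ℤ.* ℤ.+ p) ℤ.* ℤ.+ 1 ≡ ℤ.+ p ℤ.* ℤ.+ (suc (d + 0))
  cross = trans (ℤₚ.*-identityʳ _) (trans (ℤₚ.*-comm (ℤ.+ suc d) (ℤ.+ p)) (cong (λ z → ℤ.+ p ℤ.* ℤ.+ suc z) (sym (+-identityʳ d))))

module ClearDenominator (p d : ℕ) (ε : ℚ) (q*ε≡p : ℕ→ℚ (suc d) *ℚ ε ≡ ℕ→ℚ p) where

  private
    q = suc d

    q*-mono : ∀ {x y} → x ≤ℚ y → ℕ→ℚ q *ℚ x ≤ℚ ℕ→ℚ q *ℚ y
    q*-mono = ℚₚ.*-monoˡ-≤-nonNeg (ℕ→ℚ q) {{ℕ→ℚ-nonNeg q}}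

  ≤ε*⇒ : ∀ a b → ℕ→ℚ a ≤ℚ ε *ℚ ℕ→ℚ b → q * a ≤ p * b
  ≤ε*⇒ a b a≤εb = ℕ→ℚ-cancel-≤ (begin
    ℕ→ℚ (q * a)                   ≡⟨ ℕ→ℚ-* q a ⟩
    ℕ→ℚ q *ℚ ℕ→ℚ a                ≤⟨ q*-mono a≤εb ⟩
    ℕ→ℚ q *ℚ (ε *ℚ ℕ→ℚ b)         ≡⟨ ℚₚ.*-assoc (ℕ→ℚ q) ε (ℕ→ℚ b) ⟨
    (ℕ→ℚ q *ℚ ε) *ℚ ℕ→ℚ b         ≡⟨ cong (_*ℚ ℕ→ℚ b) q*ε≡p ⟩
    ℕ→ℚ p *ℚ ℕ→ℚ b                ≡⟨ ℕ→ℚ-* p b ⟨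
    ℕ→ℚ (p * b)                   ∎)
    where open ℚₚ.≤-Reasoning

  [1-ε]*≤⇒ : ∀ a b → (1ℚ -ℚ ε) *ℚ ℕ→ℚ a ≤ℚ ℕ→ℚ b → q * a ≤ q * b + p * a
  [1-ε]*≤⇒ a b [1-ε]a≤b = ℕ→ℚ-cancel-≤ (begin
    ℕ→ℚ (q * a)                                                   ≡⟨ ℕ→ℚ-* q a ⟩
    ℕ→ℚ q *ℚ ℕ→ℚ a                                                ≡⟨ split (ℕ→ℚ q) ε (ℕ→ℚ a) ⟩
    ℕ→ℚ q *ℚ ((1ℚ -ℚ ε) *ℚ ℕ→ℚ a) ℚ.+ (ℕ→ℚ q *ℚ ε) *ℚ ℕ→ℚ a       ≤⟨ ℚₚ.+-monoˡ-≤ _ (q*-mono [1-ε]a≤b) ⟩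
    ℕ→ℚ q *ℚ ℕ→ℚ b ℚ.+ (ℕ→ℚ q *ℚ ε) *ℚ ℕ→ℚ a                      ≡⟨ cong (λ z → ℕ→ℚ q *ℚ ℕ→ℚ b ℚ.+ z *ℚ ℕ→ℚ a) q*ε≡p ⟩
    ℕ→ℚ q *ℚ ℕ→ℚ b ℚ.+ ℕ→ℚ p *ℚ ℕ→ℚ a                             ≡⟨ cong₂ ℚ._+_ (ℕ→ℚ-* q b) (ℕ→ℚ-* p a) ⟨
    ℕ→ℚ (q * b) ℚ.+ ℕ→ℚ (p * a)                                   ≡⟨ ℕ→ℚ-+ (q * b) (p * a) ⟨
    ℕ→ℚ (q * b + p * a)                                           ∎)
    where
    open ℚₚ.≤-Reasoning
    split : ∀ x e y → x *ℚ y ≡ x *ℚ ((1ℚ -ℚ e) *ℚ y) ℚ.+ (x *ℚ e) *ℚ y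
    split = solve 3 (λ x e y → x :* y := x :* ((con 1ℚ :- e) :* y) :+ (x :* e) :* y) refl
      where open ℚ-Solver

  ≤1/⇒ : ∀ Q → ε ≤ℚ (ℤ.+ 1) ℚ./ suc Q → p * suc Q ≤ q
  ≤1/⇒ Q ε≤1/Q = ℕ→ℚ-cancel-≤ (begin
    ℕ→ℚ (p * suc Q)                          ≡⟨ ℕ→ℚ-* p (suc Q) ⟩
    ℕ→ℚ p *ℚ ℕ→ℚ (suc Q)                     ≡⟨ cong (_*ℚ ℕ→ℚ (suc Q)) q*ε≡p ⟨
    (ℕ→ℚ q *ℚ ε) *ℚ ℕ→ℚ (suc Q)              ≡⟨ reassoc (ℕ→ℚ q) ε (ℕ→ℚ (suc Q)) ⟩
    ℕ→ℚ q *ℚ (ℕ→ℚ (suc Q) *ℚ ε)              ≤⟨ q*-mono (ℚₚ.*-monoˡ-≤-nonNeg (ℕ→ℚ (suc Q)) {{ℕ→ℚ-nonNeg (suc Q)}} ε≤1/Q) ⟩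
    ℕ→ℚ q *ℚ (ℕ→ℚ (suc Q) *ℚ 1/Q)            ≡⟨ cong (λ z → ℕ→ℚ q *ℚ (ℕ→ℚ (suc Q) *ℚ z)) (ℚₚ.normalize-coprime (1-coprimeTo (suc Q))) ⟩
    ℕ→ℚ q *ℚ (ℕ→ℚ (suc Q) *ℚ mkℚ (ℤ.+ 1) Q _) ≡⟨ cong (ℕ→ℚ q *ℚ_) (denominator*mkℚ 1 Q (1-coprimeTo (suc Q))) ⟩
    ℕ→ℚ q *ℚ 1ℚ                               ≡⟨ ℚₚ.*-identityʳ (ℕ→ℚ q) ⟩
    ℕ→ℚ q                                     ∎)
    where
    open ℚₚ.≤-Reasoning
    1/Q = (ℤ.+ 1) ℚ./ suc Q
    reassoc : ∀ x e y → (x *ℚ e) *ℚ y ≡ x *ℚ (y *ℚ e)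
    reassoc = solve 3 (λ x e y → (x :* e) :* y := x :* (y :* e)) refl
      where open ℚ-Solver

  ¬HighDeg⇒ : ∀ M dg → dg ≤ M → ¬ HighDeg ε M dg →
              p * (M * M * M) < q * ((M ∸ dg) * (M ∸ dg) * (M ∸ dg))
  ¬HighDeg⇒ M dg dg≤M ¬high = ℕ→ℚ-cancel-< (begin-strict
    ℕ→ℚ (p * (M * M * M))                      ≡⟨ trans (ℕ→ℚ-* p _) (cong (ℕ→ℚ p *ℚ_) (ℕ→ℚ-cube M)) ⟩
    ℕ→ℚ p *ℚ (m *ℚ m *ℚ m)                     ≡⟨ cong (_*ℚ (m *ℚ m *ℚ m)) q*ε≡p ⟨
    (ℕ→ℚ q *ℚ ε) *ℚ (m *ℚ m *ℚ m)              ≡⟨ reassoc (ℕ→ℚ q) ε m ⟩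
    ℕ→ℚ q *ℚ (ε *ℚ m *ℚ m *ℚ m)                <⟨ ℚₚ.*-monoʳ-<-pos (ℕ→ℚ q) {{ℕ→ℚ-pos d}} εM³<t³ ⟩
    ℕ→ℚ q *ℚ (ℕ→ℚ t *ℚ ℕ→ℚ t *ℚ ℕ→ℚ t)         ≡⟨ trans (ℕ→ℚ-* q (t * t * t)) (cong (ℕ→ℚ q *ℚ_) (ℕ→ℚ-cube t)) ⟨
    ℕ→ℚ (q * (t * t * t))                      ∎)
    where
    open ℚₚ.≤-Reasoning
    m = ℕ→ℚ M
    t = M ∸ dg
    m-dg≡t : m -ℚ ℕ→ℚ dg ≡ ℕ→ℚ t
    m-dg≡t = begin-equality
      m -ℚ ℕ→ℚ dg                      ≡⟨ cong (λ z → ℕ→ℚ z -ℚ ℕ→ℚ dg) (m∸n+n≡m dg≤M) ⟨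
      ℕ→ℚ (t + dg) -ℚ ℕ→ℚ dg           ≡⟨ cong (_-ℚ ℕ→ℚ dg) (ℕ→ℚ-+ t dg) ⟩
      (ℕ→ℚ t ℚ.+ ℕ→ℚ dg) -ℚ ℕ→ℚ dg     ≡⟨ cancel (ℕ→ℚ t) (ℕ→ℚ dg) ⟩
      ℕ→ℚ t                            ∎
      where
      cancel : ∀ x y → (x ℚ.+ y) -ℚ y ≡ x
      cancel = solve 2 (λ x y → (x :+ y) :- y := x) refl
        where open ℚ-Solver
    εM³<t³ : ε *ℚ m *ℚ m *ℚ m <ℚ ℕ→ℚ t *ℚ ℕ→ℚ t *ℚ ℕ→ℚ t
    εM³<t³ = subst (λ z → ε *ℚ m *ℚ m *ℚ m <ℚ z *ℚ z *ℚ z) m-dg≡t (ℚₚ.≰⇒> ¬high)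
    reassoc : ∀ x e y → (x *ℚ e) *ℚ (y *ℚ y *ℚ y) ≡ x *ℚ (e *ℚ y *ℚ y *ℚ y)
    reassoc = solve 3 (λ x e y → (x :* e) :* (y :* y :* y) := x :* (e :* y :* y :* y)) refl
      where open ℚ-Solver

module _ where
  open +-*-Solver
  open ≤-Reasoning

  slack-budget : ∀ k n M Σ₁ s c a b m → n * M ≤ k * Σ₁ + k * (c * M) → Σ₁ + s ≤ M * a + M * b → a + b + m ≡ n →
                 k * s + n * M + k * (M * m) ≤ k * (M * n) + k * (c * M)
  slack-budget k n M Σ₁ s c a b m nM≤ Σ₁+s≤ a+b+m≡n = begin
    k * s + n * M + k * (M * m)                     ≤⟨ +-monoˡ-≤ (k * (M * m)) (+-monoʳ-≤ (k * s) nM≤) ⟩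
    k * s + (k * Σ₁ + k * (c * M)) + k * (M * m)
      ≡⟨ solve 6 (λ k s Σ₁ c M m → k :* s :+ (k :* Σ₁ :+ k :* (c :* M)) :+ k :* (M :* m)
                  := k :* (Σ₁ :+ s) :+ k :* (M :* m) :+ k :* (c :* M)) refl k s Σ₁ c M m ⟩
    k * (Σ₁ + s) + k * (M * m) + k * (c * M)        ≤⟨ +-monoˡ-≤ (k * (c * M)) (+-monoˡ-≤ (k * (M * m)) (*-monoʳ-≤ k Σ₁+s≤)) ⟩
    k * (M * a + M * b) + k * (M * m) + k * (c * M)
      ≡⟨ solve 6 (λ k M a b m c → k :* (M :* a :+ M :* b) :+ k :* (M :* m) :+ k :* (c :* M)
                  := k :* (M :* (a :+ b :+ m)) :+ k :* (c :* M)) refl k M a b m c ⟩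
    k * (M * (a + b + m)) + k * (c * M)             ≡⟨ cong (λ z → k * (M * z) + k * (c * M)) a+b+m≡n ⟩
    k * (M * n) + k * (c * M)                       ∎

  slack-bound : ∀ k s n M m c p q D → .{{NonZero k}} →
                k * s + n * M + k * (M * m) ≤ k * (M * n) + k * (c * M) →
                q * (c * k) ≤ p * n → q * D ≤ q * (k * m) + p * D → D + n ≡ k * n →
                q * s ≤ p * (M * n)
  slack-bound k s n M m c p q D budget qck≤pn qD≤ D+n≡kn = *-cancelˡ-≤ k (+-cancelʳ-≤ R _ _ (begin
    k * (q * s) + R
      ≡⟨ solve 6 (λ k q s n M m → k :* (q :* s) :+ (q :* (n :* M) :+ q :* (k :* (M :* m)))
                  := q :* (k :* s :+ n :* M :+ k :* (M :* m))) refl k q s n M m ⟩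
    q * (k * s + n * M + k * (M * m))                    ≤⟨ *-monoʳ-≤ q budget ⟩
    q * (k * (M * n) + k * (c * M))
      ≡⟨ solve 5 (λ k q M n c → q :* (k :* (M :* n) :+ k :* (c :* M))
                  := M :* (q :* (k :* n)) :+ M :* (q :* (c :* k))) refl k q M n c ⟩
    M * (q * (k * n)) + M * (q * (c * k))                ≡⟨ cong (λ z → M * (q * z) + M * (q * (c * k))) D+n≡kn ⟨
    M * (q * (D + n)) + M * (q * (c * k))                ≤⟨ +-monoʳ-≤ (M * (q * (D + n))) (*-monoʳ-≤ M qck≤pn) ⟩
    M * (q * (D + n)) + M * (p * n)
      ≡⟨ solve 5 (λ M q D n p → M :* (q :* (D :+ n)) :+ M :* (p :* n)
                  := M :* (q :* D) :+ M :* (q :* n) :+ M :* (p :* n)) refl M q D n p ⟩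
    M * (q * D) + M * (q * n) + M * (p * n)
      ≤⟨ +-monoˡ-≤ (M * (p * n)) (+-monoˡ-≤ (M * (q * n)) (*-monoʳ-≤ M qD≤)) ⟩
    M * (q * (k * m) + p * D) + M * (q * n) + M * (p * n)
      ≡⟨ solve 7 (λ M q k m p D n → M :* (q :* (k :* m) :+ p :* D) :+ M :* (q :* n) :+ M :* (p :* n)
                  := M :* (p :* (D :+ n)) :+ (q :* (n :* M) :+ q :* (k :* (M :* m)))) refl M q k m p D n ⟩
    M * (p * (D + n)) + R                                ≡⟨ cong (λ z → M * (p * z) + R) D+n≡kn ⟩
    M * (p * (k * n)) + R
      ≡⟨ cong (_+ R) (solve 4 (λ M p k n → M :* (p :* (k :* n)) := k :* (p :* (M :* n))) refl M p k n) ⟩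
    k * (p * (M * n)) + R                                ∎))
    where R = q * (n * M) + q * (k * (M * m))

  cube-mono-≤ : ∀ {x y} → x ≤ y → x * x * x ≤ y * y * y
  cube-mono-≤ x≤y = *-mono-≤ (*-mono-≤ x≤y x≤y) x≤y

  cube-cancel-< : ∀ {x y} → x * x * x < y * y * y → x < y
  cube-cancel-< {x} {y} x³<y³ with x <? y
  ... | yes x<y = x<y
  ... | no  x≮y = ⊥-elim (<⇒≱ x³<y³ (cube-mono-≤ (≮⇒≥ x≮y)))

  cube-bound : ∀ b t s M n p q Q → .{{NonZero b}} → .{{NonZero q}} →
               b * t ≤ s → q * s ≤ p * (M * n) → p * (M * M * M) < q * (t * t * t) → p * Q ≤ q →
               Q * Q * ((b * M) * (b * M) * (b * M)) < (n * M) * (n * M) * (n * M)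
  cube-bound b@(suc _) t s M n p q@(suc _) Q bt≤s qs≤pMn pM³<qt³ pQ≤q = *-cancelˡ-< (p * p) _ _ (begin-strict
    p * p * (Q * Q * (bM * bM * bM))
      ≡⟨ solve 3 (λ p Q Z → p :* p :* (Q :* Q :* Z) := (p :* Q) :* (p :* Q) :* Z) refl p Q (bM * bM * bM) ⟩
    (p * Q) * (p * Q) * (bM * bM * bM)     ≤⟨ *-monoˡ-≤ (bM * bM * bM) (*-mono-≤ pQ≤q pQ≤q) ⟩
    q * q * (bM * bM * bM)                 <⟨ *-cancelˡ-< p _ _ p·q²[bM]³<p·p²[nM]³ ⟩
    p * p * (nM * nM * nM)                 ∎)
    where
    bM = b * M
    nM = n * M
    qbt≤pMn : q * (b * t) ≤ p * (M * n)
    qbt≤pMn = ≤-trans (*-monoʳ-≤ q bt≤s) qs≤pMn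
    p·q²[bM]³<p·p²[nM]³ : p * (q * q * (bM * bM * bM)) < p * (p * p * (nM * nM * nM))
    p·q²[bM]³<p·p²[nM]³ = begin-strict
      p * (q * q * (bM * bM * bM))
        ≡⟨ solve 4 (λ p q b M → p :* (q :* q :* ((b :* M) :* (b :* M) :* (b :* M)))
                    := (p :* (M :* M :* M)) :* (q :* q :* (b :* b :* b))) refl p q b M ⟩
      (p * (M * M * M)) * (q * q * (b * b * b))  <⟨ *-monoˡ-< (q * q * (b * b * b)) pM³<qt³ ⟩
      (q * (t * t * t)) * (q * q * (b * b * b))
        ≡⟨ solve 3 (λ q t b → (q :* (t :* t :* t)) :* (q :* q :* (b :* b :* b))
                    := (q :* (b :* t)) :* (q :* (b :* t)) :* (q :* (b :* t))) refl q t b ⟩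
      (q * (b * t)) * (q * (b * t)) * (q * (b * t))  ≤⟨ cube-mono-≤ qbt≤pMn ⟩
      (p * (M * n)) * (p * (M * n)) * (p * (M * n))
        ≡⟨ solve 3 (λ p M n → (p :* (M :* n)) :* (p :* (M :* n)) :* (p :* (M :* n))
                    := p :* (p :* p :* ((n :* M) :* (n :* M) :* (n :* M)))) refl p M n ⟩
      p * (p * p * (nM * nM * nM))                    ∎

  cube-root-bound : ∀ N Q b n M → N * N * N ≤ Q →
                    Q * Q * ((b * M) * (b * M) * (b * M)) < (n * M) * (n * M) * (n * M) → N * N * b < n
  cube-root-bound N Q b n M N³≤Q Q²[bM]³<[nM]³ = *-cancelʳ-< M _ _ (cube-cancel-< (begin-strict
    (N * N * b * M) * (N * N * b * M) * (N * N * b * M)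
      ≡⟨ solve 3 (λ N b M → (N :* N :* b :* M) :* (N :* N :* b :* M) :* (N :* N :* b :* M)
                  := (N :* N :* N) :* (N :* N :* N) :* ((b :* M) :* (b :* M) :* (b :* M))) refl N b M ⟩
    (N * N * N) * (N * N * N) * ((b * M) * (b * M) * (b * M))  ≤⟨ *-monoˡ-≤ ((b * M) * (b * M) * (b * M)) (*-mono-≤ N³≤Q N³≤Q) ⟩
    Q * Q * ((b * M) * (b * M) * (b * M))                      <⟨ Q²[bM]³<[nM]³ ⟩
    (n * M) * (n * M) * (n * M)                                ∎))

  scaled-bound : ∀ p q Q a n → .{{NonZero p}} → q * a ≤ p * n → p * Q ≤ q → Q * a ≤ n
  scaled-bound p q Q a n qa≤pn pQ≤q = *-cancelˡ-≤ p (begin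
    p * (Q * a) ≡⟨ *-assoc p Q a ⟨
    p * Q * a   ≤⟨ *-monoˡ-≤ a pQ≤q ⟩
    q * a       ≤⟨ qa≤pn ⟩
    p * n       ∎)

  n≤2m : ∀ j p q n m → .{{NonZero q}} → 4 * p ≤ q →
         q * ((2 + j) * n) ≤ q * ((3 + j) * m) + p * ((2 + j) * n) → n ≤ 2 * m
  n≤2m j p q n m 4p≤q qD≤ = *-cancelˡ-≤ (2 * (3 + j)) (begin
    2 * (3 + j) * n        ≡⟨ solve 2 (λ j n → con 2 :* (con 3 :+ j) :* n := (con 6 :+ con 2 :* j) :* n) refl j n ⟩
    (6 + 2 * j) * n        ≤⟨ *-monoˡ-≤ n (+-monoʳ-≤ 6 (*-monoˡ-≤ j (n≤1+n 2))) ⟩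
    (6 + 3 * j) * n        ≡⟨ solve 2 (λ j n → (con 6 :+ con 3 :* j) :* n := con 3 :* ((con 2 :+ j) :* n)) refl j n ⟩
    3 * D                  ≤⟨ 3D≤4E ⟩
    4 * E                  ≡⟨ solve 2 (λ j m → con 4 :* ((con 3 :+ j) :* m) := con 2 :* (con 3 :+ j) :* (con 2 :* m)) refl j m ⟩
    2 * (3 + j) * (2 * m)  ∎)
    where
    D = (2 + j) * n
    E = (3 + j) * m
    3D≤4E : 3 * D ≤ 4 * E
    3D≤4E = *-cancelˡ-≤ q (+-cancelʳ-≤ (q * D) _ _ (begin
      q * (3 * D) + q * D        ≡⟨ solve 2 (λ q D → q :* (con 3 :* D) :+ q :* D := con 4 :* (q :* D)) refl q D ⟩
      4 * (q * D)                ≤⟨ *-monoʳ-≤ 4 qD≤ ⟩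
      4 * (q * E + p * D)
        ≡⟨ solve 4 (λ q E p D → con 4 :* (q :* E :+ p :* D) := q :* (con 4 :* E) :+ (con 4 :* p) :* D) refl q E p D ⟩
      q * (4 * E) + 4 * p * D    ≤⟨ +-monoʳ-≤ (q * (4 * E)) (*-monoˡ-≤ D 4p≤q) ⟩
      q * (4 * E) + q * D        ∎))

  codegree-lower : ∀ j n c b b₂ dC dAC → 4 * (3 + j) * (3 + j) * (3 + j) * (b + c) ≤ n →
    n * b₂ ≤ (3 + j) * ((2 + j) * dC + dAC + b₂ * b) + (3 + j) * (c * b₂) →
    dC ≤ (b + c) * (2 + j) * b₂ →
    3 * (n * b₂) ≤ 4 * ((3 + j) * dAC)
  codegree-lower j n c b b₂ dC dAC 4K³[b+c]≤n G5 dC≤ = +-cancelʳ-≤ (n * b₂) _ _ (begin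
    3 * (n * b₂) + n * b₂                ≡⟨ solve 1 (λ x → con 3 :* x :+ x := con 4 :* x) refl (n * b₂) ⟩
    4 * (n * b₂)                         ≤⟨ *-monoʳ-≤ 4 nb₂≤ ⟩
    4 * (K * dAC + K * K * K * W)        ≡⟨ *-distribˡ-+ 4 (K * dAC) (K * K * K * W) ⟩
    4 * (K * dAC) + 4 * (K * K * K * W)  ≤⟨ +-monoʳ-≤ (4 * (K * dAC)) 4K³W≤nb₂ ⟩
    4 * (K * dAC) + n * b₂               ∎)
    where
    K = 3 + j
    W = (b + c) * b₂
    nb₂≤ : n * b₂ ≤ K * dAC + K * K * K * W
    nb₂≤ = begin
      n * b₂                                              ≤⟨ G5 ⟩
      K * ((2 + j) * dC + dAC + b₂ * b) + K * (c * b₂)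
        ≤⟨ +-monoˡ-≤ (K * (c * b₂)) (*-monoʳ-≤ K (+-monoˡ-≤ (b₂ * b) (+-monoˡ-≤ dAC (*-monoʳ-≤ (2 + j) dC≤)))) ⟩
      K * ((2 + j) * ((b + c) * (2 + j) * b₂) + dAC + b₂ * b) + K * (c * b₂)
        ≡⟨ solve 5 (λ j b c b₂ dAC → (con 3 :+ j) :* ((con 2 :+ j) :* ((b :+ c) :* (con 2 :+ j) :* b₂) :+ dAC :+ b₂ :* b)
                                       :+ (con 3 :+ j) :* (c :* b₂)
                     := (con 3 :+ j) :* dAC :+ (con 3 :+ j) :* ((con 2 :+ j) :* (con 2 :+ j) :+ con 1) :* ((b :+ c) :* b₂))
                   refl j b c b₂ dAC ⟩
      K * dAC + K * ((2 + j) * (2 + j) + 1) * W           ≤⟨ +-monoʳ-≤ (K * dAC) (*-monoˡ-≤ W (*-monoʳ-≤ K [2+j]²+1≤K²)) ⟩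
      K * dAC + K * (K * K) * W                           ≡⟨ cong (λ z → K * dAC + z * W) (*-assoc K K K) ⟨
      K * dAC + K * K * K * W                             ∎
      where
      [2+j]²+1≤K² : (2 + j) * (2 + j) + 1 ≤ K * K
      [2+j]²+1≤K² = ≤-trans (m≤m+n _ (2 * j + 4))
        (≤-reflexive (solve 1 (λ j → (con 2 :+ j) :* (con 2 :+ j) :+ con 1 :+ (con 2 :* j :+ con 4)
                                   := (con 3 :+ j) :* (con 3 :+ j)) refl j))
    4K³W≤nb₂ : 4 * (K * K * K * W) ≤ n * b₂
    4K³W≤nb₂ = begin
      4 * (K * K * K * W)
        ≡⟨ solve 4 (λ K b c b₂ → con 4 :* (K :* K :* K :* ((b :+ c) :* b₂)) := (con 4 :* K :* K :* K :* (b :+ c)) :* b₂)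
                   refl K b c b₂ ⟩
      4 * K * K * K * (b + c) * b₂      ≤⟨ *-monoˡ-≤ b₂ 4K³[b+c]≤n ⟩
      n * b₂                            ∎

  m≤3[m∸j] : ∀ j m → 2 * (3 + j) ≤ m → m ≤ 3 * (m ∸ j)
  m≤3[m∸j] j m 2K≤m = begin
    m          ≡⟨ L+j≡m ⟨
    L + j      ≤⟨ +-monoʳ-≤ L (<⇒≤ j<L) ⟩
    L + L      ≤⟨ m≤m+n (L + L) L ⟩
    L + L + L  ≡⟨ solve 1 (λ L → L :+ L :+ L := con 3 :* L) refl L ⟩
    3 * L      ∎
    where
    L = m ∸ j
    L+j≡m : L + j ≡ m
    L+j≡m = m∸n+n≡m (≤-trans (m≤n+m j (6 + j))
                      (≤-trans (≤-reflexive (solve 1 (λ j → con 6 :+ j :+ j := con 2 :* (con 3 :+ j)) refl j)) 2K≤m))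
    j<L : j < L
    j<L = +-cancelˡ-< j j L (begin-strict
      j + j        <⟨ s≤s (m≤n+m (j + j) 5) ⟩
      6 + (j + j)  ≡⟨ solve 1 (λ j → con 6 :+ (j :+ j) := con 2 :* (con 3 :+ j)) refl j ⟩
      2 * (3 + j)  ≤⟨ 2K≤m ⟩
      m            ≡⟨ trans (sym L+j≡m) (+-comm L j) ⟩
      j + L        ∎)

  degAC-dominates : ∀ j n m b a b₂ b₃ dAC → .{{NonZero (n * b₂)}} →
    3 * (n * b₂) ≤ 4 * ((3 + j) * dAC) → b₃ * (m ∸ j) ≡ (1 + j) * b₂ →
    4 * (3 + j) * (3 + j) * (3 + j) * b < m → m ≤ 3 * (m ∸ j) → a ≤ n →
    (3 + j) * b * a * b₃ < dAC
  degAC-dominates j n m b a b₂ b₃ dAC 3nb₂≤4KdAC b₃-step 4K³b<m m≤3L a≤n =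
    *-cancelˡ-< (4 * K * L) _ _ (begin-strict
      (4 * K * L) * (K * b * a * b₃)  ≡⟨ solve 5 (λ K L b a b₃ → (con 4 :* K :* L) :* (K :* b :* a :* b₃)
                                                 := con 4 :* K :* K :* b :* a :* (b₃ :* L)) refl K L b a b₃ ⟩
      4 * K * K * b * a * (b₃ * L)    ≡⟨ cong (4 * K * K * b * a *_) b₃-step ⟩
      4 * K * K * b * a * ((1 + j) * b₂)
        ≤⟨ *-mono-≤ (*-monoʳ-≤ (4 * K * K * b) a≤n) (*-monoˡ-≤ b₂ (m≤n+m (1 + j) 2)) ⟩
      4 * K * K * b * n * (K * b₂)    ≡⟨ solve 4 (λ K b n b₂ → con 4 :* K :* K :* b :* n :* (K :* b₂)
                                                 := (con 4 :* K :* K :* K :* b) :* (n :* b₂)) refl K b n b₂ ⟩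
      (4 * K * K * K * b) * (n * b₂)  <⟨ *-monoˡ-< (n * b₂) 4K³b<m ⟩
      m * (n * b₂)                    ≤⟨ *-monoˡ-≤ (n * b₂) m≤3L ⟩
      3 * L * (n * b₂)                ≡⟨ solve 2 (λ L x → con 3 :* L :* x := L :* (con 3 :* x)) refl L (n * b₂) ⟩
      L * (3 * (n * b₂))              ≤⟨ *-monoʳ-≤ L 3nb₂≤4KdAC ⟩
      L * (4 * (K * dAC))             ≡⟨ solve 3 (λ K L d → L :* (con 4 :* (K :* d)) := (con 4 :* K :* L) :* d) refl K L dAC ⟩
      (4 * K * L) * dAC               ∎)
    where
    K = 3 + j
    L = m ∸ j

nCk*[n∸k]≡[k+1]*nC[k+1] : ∀ m j → binom m j * (m ∸ j) ≡ suc j * binom m (suc j)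
nCk*[n∸k]≡[k+1]*nC[k+1] zero j = begin
  binom 0 j * (0 ∸ j)        ≡⟨ cong (binom 0 j *_) (0∸n≡0 j) ⟩
  binom 0 j * 0              ≡⟨ *-zeroʳ (binom 0 j) ⟩
  0                          ≡⟨ *-zeroʳ (suc j) ⟨
  suc j * 0                  ≡⟨ cong (suc j *_) (k>n⇒nCk≡0 {0} {suc j} (s≤s z≤n)) ⟨
  suc j * binom 0 (suc j)    ∎
  where open ≡-Reasoning
nCk*[n∸k]≡[k+1]*nC[k+1] (suc m) zero = trans (*-identityˡ (suc m)) (sym (trans (*-identityˡ _) (nC1≡n (suc m))))
nCk*[n∸k]≡[k+1]*nC[k+1] (suc m) (suc j) with j <? m
... | yes j<m = begin
  binom (suc m) (suc j) * (m ∸ j)          ≡⟨ cong (_* (m ∸ j)) (nCk+nC[k+1]≡[n+1]C[k+1] m j) ⟨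
  (B₀ + B₁) * (m ∸ j)                      ≡⟨ *-distribʳ-+ (m ∸ j) B₀ B₁ ⟩
  B₀ * (m ∸ j) + B₁ * (m ∸ j)              ≡⟨ cong₂ _+_ (nCk*[n∸k]≡[k+1]*nC[k+1] m j) (cong (B₁ *_) (+-∸-assoc 1 j<m)) ⟩
  suc j * B₁ + B₁ * suc (m ∸ suc j)        ≡⟨ cong (suc j * B₁ +_) (*-suc B₁ (m ∸ suc j)) ⟩
  suc j * B₁ + (B₁ + B₁ * (m ∸ suc j))     ≡⟨ cong (λ z → suc j * B₁ + (B₁ + z)) (nCk*[n∸k]≡[k+1]*nC[k+1] m (suc j)) ⟩
  suc j * B₁ + (B₁ + suc (suc j) * B₂)
    ≡⟨ solve 3 (λ j B₁ B₂ → (con 1 :+ j) :* B₁ :+ (B₁ :+ (con 2 :+ j) :* B₂) := (con 2 :+ j) :* (B₁ :+ B₂)) refl j B₁ B₂ ⟩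
  suc (suc j) * (B₁ + B₂)                  ≡⟨ cong (suc (suc j) *_) (nCk+nC[k+1]≡[n+1]C[k+1] m (suc j)) ⟩
  suc (suc j) * binom (suc m) (suc (suc j)) ∎
  where
  open ≡-Reasoning
  open +-*-Solver
  B₀ = binom m j
  B₁ = binom m (suc j)
  B₂ = binom m (suc (suc j))
... | no j≮m = begin
  binom (suc m) (suc j) * (m ∸ j)            ≡⟨ cong (binom (suc m) (suc j) *_) (m≤n⇒m∸n≡0 (≮⇒≥ j≮m)) ⟩
  binom (suc m) (suc j) * 0                  ≡⟨ *-zeroʳ (binom (suc m) (suc j)) ⟩
  0                                          ≡⟨ *-zeroʳ (suc (suc j)) ⟨
  suc (suc j) * 0                            ≡⟨ cong (suc (suc j) *_) (k>n⇒nCk≡0 (s≤s (s≤s (≮⇒≥ j≮m)))) ⟨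
  suc (suc j) * binom (suc m) (suc (suc j))  ∎
  where open ≡-Reasoning

nCk>0 : ∀ m j → j ≤ m → 0 < binom m j
nCk>0 m       zero    _       = s≤s z≤n
nCk>0 (suc m) (suc j) (s≤s j≤m) =
  subst (0 <_) (nCk+nC[k+1]≡[n+1]C[k+1] m j) (≤-trans (nCk>0 m j j≤m) (m≤m+n _ _))


∃-below-average : ∀ {n} (P : Subset n) (f : Fin n → ℕ) {x} → x ∈ᵇ P ≡ true →
  ∃ λ y → y ∈ᵇ P ≡ true × ∣ P ∣ * f y ≤ ∑[ z ← allVertices n ] (⟦ z ∈ᵇ P ⟧ * f z)
∃-below-average {n} P f {x} x∈P = y , y∈P , (begin
  ∣ P ∣ * f y                          ≡⟨ cong (_* f y) (∣∣≡∑ P) ⟩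
  ∑[ z ← 𝒱 ] ⟦ z ∈ᵇ P ⟧ * f y          ≡⟨ *-distribʳ-∑ (f y) 𝒱 _ ⟩
  ∑[ z ← 𝒱 ] (⟦ z ∈ᵇ P ⟧ * f y)        ≤⟨ ∑-mono-≤ 𝒱 (λ z → ⟦⟧*-mono-≤ (z ∈ᵇ P) (minimal z)) ⟩
  ∑[ z ← 𝒱 ] (⟦ z ∈ᵇ P ⟧ * f z)        ∎)
  where
  open ≤-Reasoning
  𝒱 = allVertices n
  members = filter (_∈? P) 𝒱
  y = argmin f x members
  y∈P : y ∈ᵇ P ≡ true
  y∈P = argmin-all f {P = λ z → z ∈ᵇ P ≡ true} x∈P (All.map ∈⇒∈ᵇ (all-filter (_∈? P) 𝒱))
  minimal : ∀ z → z ∈ᵇ P ≡ true → f y ≤ f z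
  minimal z z∈P = All.lookup (f[argmin]≤f[xs] x members) (∈-filter⁺ (_∈? P) (∈-allFin z) (∈ᵇ⇒∈ z∈P))

∈ᵇ⇒∣∣≢0 : ∀ {n} (P : Subset n) x → x ∈ᵇ P ≡ true → NonZero ∣ P ∣
∈ᵇ⇒∣∣≢0 (true  ∷ P) zero    _   = _
∈ᵇ⇒∣∣≢0 (true  ∷ P) (suc x) _   = _
∈ᵇ⇒∣∣≢0 (false ∷ P) (suc x) x∈P = ∈ᵇ⇒∣∣≢0 P x x∈P

positive⇒fraction : ∀ {ε} → 0ℚ <ℚ ε → Σ ℕ λ p → Σ ℕ λ d → NonZero p × ℕ→ℚ (suc d) *ℚ ε ≡ ℕ→ℚ p
positive⇒fraction {mkℚ (ℤ.+ suc p) d cop} _ = suc p , d , _ , denominator*mkℚ (suc p) d cop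
positive⇒fraction {mkℚ (ℤ.+ zero) d _} 0<ε with ℚₚ.toℚᵘ-mono-< 0<ε
... | ℚᵘ.*<* 0<0 = ⊥-elim (ℤₚ.<-irrefl refl 0<0)
positive⇒fraction {mkℚ ℤ.-[1+ x ] d _} 0<ε with ℚₚ.toℚᵘ-mono-< 0<ε
... | ℚᵘ.*<* ()

-- With N = 8k³ and ε ≤ 1/(N³+1) one gets N c ≤ n and N² |B| < n, which the final estimate needs.
threshold : ℕ → ℕ
threshold k = 8 * k * k * k

ε₀ : ℕ → ℚ
ε₀ k = (ℤ.+ 1) ℚ./ suc (threshold k * threshold k * threshold k)

ε₀>0 : ∀ k → 0ℚ <ℚ ε₀ k
ε₀>0 k = subst (0ℚ <ℚ_) (sym (ℚₚ.normalize-coprime (1-coprimeTo (suc (N * N * N)))))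
                (ℚₚ.positive⁻¹ (mkℚ (ℤ.+ 1) (N * N * N) _))
  where N = threshold k

module Lemma5p12
  (j p d : ℕ) .{{_ : NonZero p}} (ε : ℚ) (q*ε≡p : ℕ→ℚ (suc d) *ℚ ε ≡ ℕ→ℚ p) (ε≤ε₀ : ε ≤ℚ ε₀ (3 + j))
  (n : ℕ) (4k≤n : 4 * (3 + j) ≤ n)
  (c : ℕ) (ck≤εn : ℕ→ℚ (c * (3 + j)) ≤ℚ (ε *ℚ ℕ→ℚ n))
  (H : Hypergraph n) (uniform : Uniform (3 + j) H)
  (codegree : (T : Subset n) → ∣ T ∣ ≡ (3 + j) ∸ 1 → n ≤ (3 + j) * (codeg H T + c))
  (S C : Subset n) (S-large : ((1ℚ -ℚ ε) *ℚ ℕ→ℚ (((3 + j) ∸ 1) * n)) ≤ℚ ℕ→ℚ ((3 + j) * ∣ S ∣))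
  (S⊆C : S ⊆ C) (C-independent : Independent H C)
  where

  private
    k = 3 + j
    q = suc d
    A = Aset k ε H C
    B = Bset k ε H C
    m = ∣ C ∣
    M = binom m (2 + j)
    b₂ = binom m (1 + j)
    N = threshold k
    Q = N * N * N
    𝒫 = allSubsets n
    𝒱 = allVertices n
    partition = ABC-partition k ε H C

  open ClearDenominator p d ε q*ε≡p
  open Counting k H uniform C

  pQ≤q : p * suc Q ≤ q
  pQ≤q = ≤1/⇒ Q ε≤ε₀

  N≤Q : N ≤ Q
  N≤Q = ≤-trans (m≤m*n N N) (m≤m*n (N * N) N)

  c-small : N * c ≤ n
  c-small = ≤-trans (*-mono-≤ (≤-trans N≤Q (n≤1+n Q)) (m≤m*n c k))
                    (scaled-bound p q (suc Q) (c * k) n (≤ε*⇒ (c * k) n ck≤εn) pQ≤q)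

  S-large′ : q * ((2 + j) * n) ≤ q * (k * m) + p * ((2 + j) * n)
  S-large′ = ≤-trans ([1-ε]*≤⇒ _ _ S-large) (+-monoˡ-≤ _ (*-monoʳ-≤ q (*-monoʳ-≤ k (p⊆q⇒∣p∣≤∣q∣ S⊆C))))

  n≤2m′ : n ≤ 2 * m
  n≤2m′ = n≤2m j p q n m 4p≤q S-large′
    where
    4≤Q : 4 ≤ suc Q
    4≤Q = ≤-trans (m≤m+n 4 4) (≤-trans (≤-trans (m≤m*n 8 k) (≤-trans (m≤m*n (8 * k) k) (m≤m*n (8 * k * k) k)))
                                       (≤-trans N≤Q (n≤1+n Q)))
    4p≤q : 4 * p ≤ q
    4p≤q = ≤-trans (≤-reflexive (*-comm 4 p)) (≤-trans (*-monoʳ-≤ p 4≤Q) pQ≤q)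

  Σ₁ sB : ℕ
  Σ₁ = ∑[ x ← 𝒱 ] (⟦ not (x ∈ᵇ C) ⟧ * degC H C x)
  sB = ∑[ x ← 𝒱 ] (⟦ x ∈ᵇ B ⟧ * slack partition x)

  codegree-C : n * M ≤ k * Σ₁ + k * (c * M)
  codegree-C = subst₂ (λ a b → n * a ≤ k * b + k * (c * a)) (∑-subsetOfSize C (2 + j)) (sym (∑-degC-outside C-independent))
    (codegree-sum k c H codegree (subsetOfSize C (2 + j)) (λ T → T) (λ T ι → proj₂ (subsetOfSize-true C (2 + j) T ι)))

  slack-small : q * sB ≤ p * (M * n)
  slack-small = slack-bound k sB n M m c p q ((2 + j) * n)
    (slack-budget k n M Σ₁ sB c ∣ A ∣ ∣ B ∣ m codegree-C (degree-budget partition) (∣∣-partition partition))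
    (≤ε*⇒ (c * k) n ck≤εn) S-large′ (solve 2 (λ j n → (con 2 :+ j) :* n :+ n := (con 3 :+ j) :* n) refl j n)
    where open +-*-Solver

  B-small : ∀ {v} → v ∈ᵇ B ≡ true → N * N * ∣ B ∣ < n
  B-small {v} v∈B = cube-root-bound N (suc Q) ∣ B ∣ n M (n≤1+n Q)
    (cube-bound ∣ B ∣ (slack partition x) sB M n p q (suc Q) {{∈ᵇ⇒∣∣≢0 B v v∈B}} below-average slack-small
      (¬HighDeg⇒ M (degC H C x) (degC≤binom x (Bset⇒∉C k ε H C x x∈B)) (Bset⇒¬HighDeg k ε H C x x∈B)) pQ≤q)
    where
    average = ∃-below-average B (slack partition) {v} v∈B
    x = proj₁ average
    x∈B = proj₁ (proj₂ average)
    below-average = proj₂ (proj₂ average)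

  codegree-at : ∀ v → v ∈ᵇ C ≡ false →
    n * b₂ ≤ k * ((2 + j) * degC H C v + degAC k H A C v + b₂ * ∣ B ∣) + k * (c * b₂)
  codegree-at v v∉C = ≤-trans
    (subst (λ a → n * a ≤ k * ∑[ S ← 𝒫 ] (⟦ subsetOfSize C (1 + j) S ⟧ * codeg H (S ∪ ⁅ v ⁆)) + k * (c * a))
           (∑-subsetOfSize C (1 + j))
           (codegree-sum k c H codegree (subsetOfSize C (1 + j)) (_∪ ⁅ v ⁆) ∣S∪v∣≡k-1))
    (+-monoˡ-≤ (k * (c * b₂)) (*-monoʳ-≤ k (∑-codeg-link partition (s≤s (s≤s z≤n)) v v∉C)))
    where
    ∣S∪v∣≡k-1 : ∀ S → subsetOfSize C (1 + j) S ≡ true → ∣ S ∪ ⁅ v ⁆ ∣ ≡ 2 + j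
    ∣S∪v∣≡k-1 S ι = trans (∣∪⁅⁆∣ S v (⊆ᵇ-∉ {p = S} (proj₁ (subsetOfSize-true C (1 + j) S ι)) v v∉C))
                          (cong suc (proj₂ (subsetOfSize-true C (1 + j) S ι)))

  ∉D⇒degC≤′ : ∀ vs → IsDegListing H C B vs → ∀ d′ → IsD k c H C vs d′ → ∀ {v} → v ∈ B → ¬ (v ∈ˡ Dlist vs d′) →
              degC H C v ≤ (∣ B ∣ + c) * (2 + j) * b₂
  ∉D⇒degC≤′ vs (unique , lists , _) d′ isD {v} v∈B v∉D =
    ≤-trans (∉D⇒degC≤ k c H C vs d′ isD (proj₂ (lists v) v∈B) v∉D)
            (*-monoˡ-≤ b₂ (*-monoˡ-≤ (2 + j) (+-monoˡ-≤ c (length≤∣∣ vs B unique (λ x x∈vs → ∈⇒∈ᵇ (proj₁ (lists x) x∈vs))))))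

  2k≤m : 2 * k ≤ m
  2k≤m = *-cancelˡ-≤ 2 (≤-trans (≤-reflexive (sym (*-assoc 2 2 k))) (≤-trans 4k≤n n≤2m′))

  b₂>0 : 0 < b₂
  b₂>0 = nCk>0 m (1 + j) (≤-trans (m≤n+m (1 + j) 2) (≤-trans (m≤n+m k k) (≤-trans (≤-reflexive (cong (k +_) (sym (+-identityʳ k)))) 2k≤m)))

  ∣A∣≤n : ∣ A ∣ ≤ n
  ∣A∣≤n = subst (∣ A ∣ ≤_) (∣∣-partition partition) (≤-trans (m≤m+n ∣ A ∣ ∣ B ∣) (m≤m+n _ m))

  module _ (v : Fin n) (v∈B : v ∈ᵇ B ≡ true) where

    Nb<n : N * ∣ B ∣ < n
    Nb<n = ≤-<-trans (*-monoˡ-≤ ∣ B ∣ (m≤m*n N N)) (B-small {v} v∈B)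

    4k³b<m : 4 * k * k * k * ∣ B ∣ < m
    4k³b<m = *-cancelˡ-< 2 _ _ (begin-strict
      2 * (4 * k * k * k * ∣ B ∣)
        ≡⟨ solve 2 (λ k b → con 2 :* (con 4 :* k :* k :* k :* b) := con 8 :* k :* k :* k :* b) refl k ∣ B ∣ ⟩
      N * ∣ B ∣                    <⟨ Nb<n ⟩
      n                            ≤⟨ n≤2m′ ⟩
      2 * m                        ∎)
      where
      open +-*-Solver
      open ≤-Reasoning

    4k³[b+c]≤n : 4 * k * k * k * (∣ B ∣ + c) ≤ n
    4k³[b+c]≤n = *-cancelˡ-≤ 2 (begin
      2 * (4 * k * k * k * (∣ B ∣ + c))
        ≡⟨ solve 3 (λ k b c → con 2 :* (con 4 :* k :* k :* k :* (b :+ c)) := con 8 :* k :* k :* k :* b :+ con 8 :* k :* k :* k :* c)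
                   refl k ∣ B ∣ c ⟩
      N * ∣ B ∣ + N * c                  ≤⟨ +-mono-≤ (<⇒≤ Nb<n) c-small ⟩
      n + n                              ≡⟨ solve 1 (λ n → n :+ n := con 2 :* n) refl n ⟩
      2 * n                              ∎)
      where
      open +-*-Solver
      open ≤-Reasoning

  degAC-large : ∀ vs → IsDegListing H C B vs → ∀ d′ → IsD k c H C vs d′ → ∀ v → v ∈ B → ¬ (v ∈ˡ Dlist vs d′) →
                k * ∣ B ∣ * ∣ A ∣ * binom m j < degAC k H A C v
  degAC-large vs listing d′ isD v v∈B v∉D =
    degAC-dominates j n m ∣ B ∣ ∣ A ∣ b₂ (binom m j) (degAC k H A C v) {{m*n≢0 n b₂ {{>-nonZero n>0}} {{>-nonZero b₂>0}}}}
      (codegree-lower j n c ∣ B ∣ b₂ (degC H C v) (degAC k H A C v) (4k³[b+c]≤n v v∈ᵇB)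
        (codegree-at v (Bset⇒∉C k ε H C v v∈ᵇB)) (∉D⇒degC≤′ vs listing d′ isD v∈B v∉D))
      (nCk*[n∸k]≡[k+1]*nC[k+1] m j) (4k³b<m v v∈ᵇB) (m≤3[m∸j] j m 2k≤m) ∣A∣≤n
    where
    v∈ᵇB = ∈⇒∈ᵇ {x = v} {B} v∈B
    n>0 = ≤-trans (s≤s z≤n) 4k≤n

lemma5p12 :
  (k : ℕ) → 3 ≤ k →
  Σ ℚ λ ε₀ → (0ℚ <ℚ ε₀) ×
  ((ε : ℚ) → 0ℚ <ℚ ε → ε ≤ℚ ε₀ →
   Σ ℕ λ n₀ → (n : ℕ) → n₀ ≤ n → k ∣ n →
   (c : ℕ) → ℕ→ℚ (c * k) ≤ℚ (ε *ℚ ℕ→ℚ n) →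
   (H : Hypergraph n) → Uniform k H →
   ((T : Subset n) → ∣ T ∣ ≡ k ∸ 1 → n ≤ k * (codeg H T + c)) →
   (S C : Subset n) → Independent H S →
   ((1ℚ -ℚ ε) *ℚ ℕ→ℚ ((k ∸ 1) * n)) ≤ℚ ℕ→ℚ (k * ∣ S ∣) →
   S ⊆ C → MaximalIndependent H C → k * ∣ C ∣ ≤ (k ∸ 1) * n →
   (vs : List (Fin n)) → IsDegListing H C (Bset k ε H C) vs →
   (d : ℕ) → IsD k c H C vs d →
   d < length vs →
   (v : Fin n) → v ∈ Bset k ε H C → ¬ (v ∈ˡ Dlist vs d) →
   k * ∣ Bset k ε H C ∣ * ∣ Aset k ε H C ∣ * binom ∣ C ∣ (k ∸ 3)
     < degAC k H (Aset k ε H C) C v)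

lemma5p12 zero ()
lemma5p12 (suc zero) (s≤s ())
lemma5p12 (suc (suc zero)) (s≤s (s≤s ()))
lemma5p12 (suc (suc (suc j))) _ = ε₀ (3 + j) , ε₀>0 (3 + j) , λ ε ε>0 ε≤ε₀ →
  let (p , d , p≢0 , q*ε≡p) = positive⇒fraction ε>0 in
  4 * (3 + j) , λ n 4k≤n _ c ck≤εn H uniform codegree S C _ S-large S⊆C maximal _ vs listing d′ isD _ v v∈B v∉D →
    Lemma5p12.degAC-large j p d {{p≢0}} ε q*ε≡p ε≤ε₀ n 4k≤n c ck≤εn H uniform codegree S C S-large S⊆C (proj₁ maximal)
                          vs listing d′ isD v v∈B v∉D
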